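{- Let $s$ be the greatest element of $\{1,2,\ldots,t-1\}$ that divides $t$. Then any two distinct $F$-chains of $\mathrm{PG}(1,E)$ have at most $q^s+1$ common points.
   Context: Let $q$ be a prime power, $t\ge 2$, and $E=\mathrm{End}_{\mathbb{F}_q}(\mathbb{F}_{q^t})$, the ring of $\mathbb{F}_q$-linear maps $\mathbb{F}_{q^t}\to\mathbb{F}_{q^t}$, maps written on the right and composed left to right; $E^*$ is its unit group. For $a\in\mathbb{F}_{q^t}$ let $\rho_a\in E$ be $x\mapsto ax$. $E^2$ is a left $E$-module of row vectors with $\mathrm{GL}_2(E)$ acting from the right. A pair $(\alpha,\beta)\in E^2$ is admissible if it is the first row of a matrix in $\mathrm{GL}_2(E)$. The projective line $\mathrm{PG}(1,E)$ is the set of cyclic submodules $E(\alpha,\beta)$ with $(\alpha,\beta)$ admissible (points). A projectivity of $\mathrm{PG}(1,E)$ is a map $E(\alpha,\beta)\mapsto E((\alpha,\beta)M)$ for a fixed $M\in\mathrm{GL}_2(E)$. $\mathrm{PG}(1,F)$ denotes $\{E(\rho_a,\rho_b): (a,b)\in\mathbb{F}_{q^t}^2\setminus\{(0,0)\}\}$. An $F$-chain is the image of $\mathrm{PG}(1,F)$ under a projectivity of $\mathrm{PG}(1,E)$. -}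

module Defs where

open import Level using (0ℓ)
open import Data.Nat using (ℕ; _≤_; _<_; _^_) renaming (suc to sucℕ)
open import Data.Nat.Divisibility using (_∣_)
open import Data.Nat.Primality using (Prime)
open import Data.Fin using (Fin)
open import Data.Bool using (Bool; true)
open import Data.Product using (Σ; ∃; ∃-syntax; _×_; _,_)
open import Data.List using (List; length)
open import Data.List.Relation.Unary.All using (All)
open import Data.List.Relation.Unary.AllPairs using (AllPairs)
open import Relation.Binary.PropositionalEquality using (_≡_; _≢_)
open import Relation.Nullary using (¬_)
open import Function.Bundles using (_↔_)
open import Algebra.Structures using (IsCommutativeRing)

IsPrimePower : ℕ → Set
IsPrimePower q = ∃[ p ] ∃[ k ] (Prime p × q ≡ p ^ sucℕ k)

record Field : Set₁ where
  field
    Carrier : Set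
    _+_ _*_ : Carrier → Carrier → Carrier
    -_ : Carrier → Carrier
    0# 1# : Carrier
    isCommutativeRing : IsCommutativeRing _≡_ _+_ _*_ -_ 0# 1#
    0≢1 : 0# ≢ 1#
    inverse : ∀ x → x ≢ 0# → ∃[ y ] (x * y ≡ 1#)
  infixl 6 _+_
  infixl 7 _*_

-- The data of  F_q ⊆ F_{q^t} : a field L with q^t elements together with a
-- subfield K (given by a Boolean membership predicate) with q elements.
record FieldExt (q t : ℕ) : Set₁ where
  field
    L : Field
  open Field L public
  field
    cardL : Carrier ↔ Fin (q ^ t)
    inK : Carrier → Bool
    K0 : inK 0# ≡ true
    K1 : inK 1# ≡ true
    K+ : ∀ x y → inK x ≡ true → inK y ≡ true → inK (x + y) ≡ true
    K- : ∀ x → inK x ≡ true → inK (- x) ≡ true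
    K* : ∀ x y → inK x ≡ true → inK y ≡ true → inK (x * y) ≡ true
    Kinv : ∀ x y → inK x ≡ true → x * y ≡ 1# → inK y ≡ true
    cardK : Σ Carrier (λ x → inK x ≡ true) ↔ Fin q

module Chains {q t : ℕ} (FE : FieldExt q t) where
  open FieldExt FE

  -- Elements of E = End_{F_q}(F_{q^t}) are F_q-linear maps L → L.
  -- Maps are written on the right: "x φ" is  φ x , and  φ ∘ₑ ψ  means "first φ, then ψ".
  Map : Set
  Map = Carrier → Carrier

  IsLinear : Map → Set
  IsLinear f = (∀ x y → f (x + y) ≡ f x + f y)
             × (∀ c x → inK c ≡ true → f (c * x) ≡ c * f x)

  _≈ₑ_ : Map → Map → Set
  f ≈ₑ g = ∀ x → f x ≡ g x

  _·ₑ_ : Map → Map → Map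
  (φ ·ₑ ψ) x = ψ (φ x)

  _+ₑ_ : Map → Map → Map
  (φ +ₑ ψ) x = φ x + ψ x

  0ₑ 1ₑ : Map
  0ₑ x = 0#
  1ₑ x = x

  ρ : Carrier → Map
  ρ a x = a * x

  Pair : Set
  Pair = Map × Map

  record Mat : Set where
    constructor mat
    field m11 m12 m21 m22 : Map

  IsLinearMat : Mat → Set
  IsLinearMat (mat a b c d) = IsLinear a × IsLinear b × IsLinear c × IsLinear d

  _·ₘ_ : Mat → Mat → Mat
  mat a b c d ·ₘ mat a' b' c' d' =
    mat ((a ·ₑ a') +ₑ (b ·ₑ c')) ((a ·ₑ b') +ₑ (b ·ₑ d'))
        ((c ·ₑ a') +ₑ (d ·ₑ c')) ((c ·ₑ b') +ₑ (d ·ₑ d'))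

  _≈ₘ_ : Mat → Mat → Set
  mat a b c d ≈ₘ mat a' b' c' d' = (a ≈ₑ a') × (b ≈ₑ b') × (c ≈ₑ c') × (d ≈ₑ d')

  Iₘ : Mat
  Iₘ = mat 1ₑ 0ₑ 0ₑ 1ₑ

  InGL2 : Mat → Set
  InGL2 M = IsLinearMat M ×
            (∃[ N ] (IsLinearMat N × (M ·ₘ N) ≈ₘ Iₘ × (N ·ₘ M) ≈ₘ Iₘ))

  _⋆_ : Pair → Mat → Pair
  (α , β) ⋆ mat a b c d = ((α ·ₑ a) +ₑ (β ·ₑ c)) , ((α ·ₑ b) +ₑ (β ·ₑ d))

  _•_ : Map → Pair → Pair
  ξ • (α , β) = (ξ ·ₑ α) , (ξ ·ₑ β)

  _≈ₚ_ : Pair → Pair → Set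
  (α , β) ≈ₚ (γ , δ) = (α ≈ₑ γ) × (β ≈ₑ δ)

  Admissible : Pair → Set
  Admissible (α , β) = ∃[ c ] ∃[ d ] InGL2 (mat α β c d)

  _∈E_ : Pair → Pair → Set
  w ∈E v = ∃[ ξ ] (IsLinear ξ × w ≈ₚ (ξ • v))

  SameSub : Pair → Pair → Set
  SameSub v w = (∀ ξ → IsLinear ξ → (ξ • v) ∈E w)
              × (∀ ξ → IsLinear ξ → (ξ • w) ∈E v)

  -- the point E v (v admissible) lies on the F-chain that is the image of
  -- PG(1,F) under the projectivity induced by M
  OnChain : Mat → Pair → Set
  OnChain M v = ∃[ a ] ∃[ b ] (¬ (a ≡ 0# × b ≡ 0#) × SameSub v ((ρ a , ρ b) ⋆ M))

  DistinctChains : Mat → Mat → Set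
  DistinctChains M₁ M₂ =
    ¬ (∀ v → Admissible v → (OnChain M₁ v → OnChain M₂ v) × (OnChain M₂ v → OnChain M₁ v))

  CommonPoints : Mat → Mat → List Pair → Set
  CommonPoints M₁ M₂ vs =
    All (λ v → Admissible v × OnChain M₁ v × OnChain M₂ v) vs
    × AllPairs (λ v w → ¬ SameSub v w) vs

IsGreatestProperDivisor : ℕ → ℕ → Set
IsGreatestProperDivisor t s =
  1 ≤ s × s < t × s ∣ t × (∀ d → 1 ≤ d → d < t → d ∣ t → d ≤ s)

-- Points of the chain with matrix M are coordinatised by nonzero u ∈ F_{q^t}², the point being
-- E((ρ u₁ , ρ u₂) M); proportional vectors give the same point, independent ones distinct points.
-- A point with coordinates u on the first chain and w on the second yields an F_q-linear bijection ζ
-- with ψ (u x) = w ζ(x), where ψ is the action of M₁ M₂⁻¹ on rows. Three common points give bases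
-- (U₁ , U₂) and (W₁ , W₂) and one such f with ψ (U₁ c + U₂ d) = W₁ f(c) + W₂ f(d). The elements a
-- with f(a y) f(1) = f(a) f(y) for all y form a subfield S ⊇ F_q. If S = F_{q^t}, then y ↦ f(y) / f(1)
-- matches every point of one chain with a point of the other, so the chains coincide. Otherwise S is
-- a proper subfield, hence |S| = q^d for a proper divisor d of t, so |S| ≤ q^s. Every common point
-- u = U₁ a + U₂ b has slope b / a in S or has a = 0, and distinct common points have distinct slopes,
-- which leaves room for at most q^s + 1 of them.

module Submission where

open import Defs
open import Algebra.Bundles using (CommutativeRing)
open import Algebra.Solver.Ring.AlmostCommutativeRing using (_-Raw-AlmostCommutative⟶_; fromCommutativeRing)
open import Axiom.UniquenessOfIdentityProofs using (module Decidable⇒UIP)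
open import Data.Bool as Bool using (Bool; true; false)
open import Data.Empty using (⊥-elim)
open import Data.Fin as Fin using (Fin)
import Data.Fin.Properties as Fin
open import Data.Integer as ℤ using (ℤ; +_; -[1+_]; _⊖_; _◃_; sign; ∣_∣)
import Data.Integer.Properties as ℤ
open import Data.List using (List; []; _∷_; length; lookup)
open import Data.List.Membership.Propositional.Properties using (∈-lookup)
import Data.List.Relation.Unary.All as All
open import Data.List.Relation.Unary.AllPairs using (AllPairs; []; _∷_)
import Data.Maybe as Maybe
open import Data.Nat as ℕ using (ℕ; zero; suc; _≤_; _<_; _^_; z≤n; s≤s)
import Data.Nat.Properties as ℕ
open import Data.Nat.Divisibility using (divides)
open import Data.Nat.Primality using (prime)
open import Data.Product using (Σ; ∃; ∃-syntax; _×_; _,_; proj₁; proj₂)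
open import Data.Product.Function.NonDependent.Propositional using (_×-↔_)
open import Data.Sign as Sign using (Sign)
open import Function using (_∘_)
open import Function.Bundles using (_↔_; Inverse; Injection; mk↔ₛ′)
open import Function.Definitions using (Injective)
open import Function.Properties.Inverse using (↔-sym; ↔-trans; ↔⇒↣)
open import Relation.Binary.Definitions using (DecidableEquality; Symmetric; tri<; tri≈; tri>)
open import Relation.Binary.PropositionalEquality using (_≡_; _≢_; refl; sym; trans; cong; cong₂; subst; module ≡-Reasoning)
open import Relation.Nullary using (¬_; Dec; yes; no; does; ¬?; _×-dec_; map′; dec⇒maybe)
open import Relation.Nullary.Decidable using (via-injection; dec-true; dec-false; decidable-stable)
-- Integer coefficients make normalisation compute in any commutative ring (so x - x reduces to 0),
-- which the reflective solver, using the ring itself as coefficients, cannot do for an abstract field.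
module ℤ-Solver {c ℓ} (R : CommutativeRing c ℓ) where
  open CommutativeRing R renaming (refl to ≈-refl; sym to ≈-sym; trans to ≈-trans)
  open import Algebra.Properties.Ring ring using (-‿distribˡ-*; -‿distribʳ-*)
  open import Algebra.Properties.Group +-group using (⁻¹-involutive; ε⁻¹≈ε)
  open import Algebra.Properties.AbelianGroup +-abelianGroup using (⁻¹-∙-comm)
  open import Algebra.Properties.Semiring.Mult.TCOptimised semiring using (1+×; ×-homo-+; ×1-homo-*) renaming (_×_ to _·_)
  open import Relation.Binary.Reasoning.Setoid setoid

  fromℤ : ℤ → Carrier
  fromℤ (+ n) = n · 1#
  fromℤ -[1+ n ] = - (suc n · 1#)

  private
    -‿cong₂ : ∀ {a b c d} → a ≈ b → c ≈ d → a - c ≈ b - d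
    -‿cong₂ p q = +-cong p (-‿cong q)

    -‿shift : ∀ a b → (1# + a) - (1# + b) ≈ a - b
    -‿shift a b = begin
      (1# + a) - (1# + b)        ≈⟨ +-congˡ (⁻¹-∙-comm 1# b) ⟨
      (1# + a) + (- 1# - b)      ≈⟨ +-congʳ (+-comm 1# a) ⟩
      (a + 1#) + (- 1# - b)      ≈⟨ +-assoc a 1# _ ⟩
      a + (1# + (- 1# - b))      ≈⟨ +-congˡ (+-assoc 1# (- 1#) (- b)) ⟨
      a + ((1# - 1#) - b)        ≈⟨ +-congˡ (+-congʳ (-‿inverseʳ 1#)) ⟩
      a + (0# - b)               ≈⟨ +-congˡ (+-identityˡ (- b)) ⟩
      a - b                      ∎

  fromℤ-⊖ : ∀ m n → fromℤ (m ⊖ n) ≈ m · 1# - n · 1#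
  fromℤ-⊖ m zero = begin
    m · 1#        ≈⟨ +-identityʳ _ ⟨
    m · 1# + 0#   ≈⟨ +-congˡ ε⁻¹≈ε ⟨
    m · 1# - 0#   ∎
  fromℤ-⊖ zero (suc n) = ≈-sym (+-identityˡ _)
  fromℤ-⊖ (suc m) (suc n) = begin
    fromℤ (suc m ⊖ suc n)           ≡⟨ cong fromℤ (ℤ.[1+m]⊖[1+n]≡m⊖n m n) ⟩
    fromℤ (m ⊖ n)                   ≈⟨ fromℤ-⊖ m n ⟩
    m · 1# - n · 1#                 ≈⟨ -‿shift _ _ ⟨
    (1# + m · 1#) - (1# + n · 1#)   ≈⟨ -‿cong₂ (1+× m 1#) (1+× n 1#) ⟨
    suc m · 1# - suc n · 1#         ∎

  fromℤ-+ : ∀ i j → fromℤ (i ℤ.+ j) ≈ fromℤ i + fromℤ j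
  fromℤ-+ (+ m) (+ n) = ×-homo-+ 1# m n
  fromℤ-+ (+ m) -[1+ n ] = fromℤ-⊖ m (suc n)
  fromℤ-+ -[1+ m ] (+ n) = ≈-trans (fromℤ-⊖ n (suc m)) (+-comm _ _)
  fromℤ-+ -[1+ m ] -[1+ n ] = begin
    - (suc (suc (m ℕ.+ n)) · 1#)        ≡⟨ cong (λ k → - (suc k · 1#)) (ℕ.+-suc m n) ⟨
    - ((suc m ℕ.+ suc n) · 1#)          ≈⟨ -‿cong (×-homo-+ 1# (suc m) (suc n)) ⟩
    - (suc m · 1# + suc n · 1#)         ≈⟨ ⁻¹-∙-comm _ _ ⟨
    - (suc m · 1#) - (suc n · 1#)       ∎

  signed : Sign → Carrier → Carrier
  signed Sign.+ x = x
  signed Sign.- x = - x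

  fromℤ-◃ : ∀ s n → fromℤ (s ◃ n) ≈ signed s (n · 1#)
  fromℤ-◃ Sign.+ zero = ≈-refl
  fromℤ-◃ Sign.- zero = ≈-sym ε⁻¹≈ε
  fromℤ-◃ Sign.+ (suc n) = ≈-refl
  fromℤ-◃ Sign.- (suc n) = ≈-refl

  fromℤ-signAbs : ∀ i → fromℤ i ≈ signed (sign i) (∣ i ∣ · 1#)
  fromℤ-signAbs (+ n) = ≈-refl
  fromℤ-signAbs -[1+ n ] = ≈-refl

  signed-* : ∀ s t x y → signed (s Sign.* t) (x * y) ≈ signed s x * signed t y
  signed-* Sign.+ Sign.+ x y = ≈-refl
  signed-* Sign.+ Sign.- x y = -‿distribʳ-* x y
  signed-* Sign.- Sign.+ x y = -‿distribˡ-* x y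
  signed-* Sign.- Sign.- x y = begin
    x * y              ≈⟨ ⁻¹-involutive _ ⟨
    - - (x * y)        ≈⟨ -‿cong (-‿distribˡ-* x y) ⟩
    - (- x * y)        ≈⟨ -‿distribʳ-* (- x) y ⟩
    - x * - y          ∎

  fromℤ-* : ∀ i j → fromℤ (i ℤ.* j) ≈ fromℤ i * fromℤ j
  fromℤ-* i j = begin
    fromℤ (σ ◃ ∣ i ∣ ℕ.* ∣ j ∣)                                  ≈⟨ fromℤ-◃ σ (∣ i ∣ ℕ.* ∣ j ∣) ⟩
    signed σ ((∣ i ∣ ℕ.* ∣ j ∣) · 1#)                           ≈⟨ signed-cong σ (×1-homo-* ∣ i ∣ ∣ j ∣) ⟩
    signed σ ((∣ i ∣ · 1#) * (∣ j ∣ · 1#))                      ≈⟨ signed-* (sign i) (sign j) _ _ ⟩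
    signed (sign i) (∣ i ∣ · 1#) * signed (sign j) (∣ j ∣ · 1#)   ≈⟨ *-cong (fromℤ-signAbs i) (fromℤ-signAbs j) ⟨
    fromℤ i * fromℤ j                                           ∎
    where
    σ = sign i Sign.* sign j
    signed-cong : ∀ s {x y} → x ≈ y → signed s x ≈ signed s y
    signed-cong Sign.+ p = p
    signed-cong Sign.- p = -‿cong p

  fromℤ-neg : ∀ i → fromℤ (ℤ.- i) ≈ - fromℤ i
  fromℤ-neg (+ zero) = ≈-sym ε⁻¹≈ε
  fromℤ-neg (+ suc n) = ≈-refl
  fromℤ-neg -[1+ n ] = ≈-sym (⁻¹-involutive _)

  homomorphism : ℤ.+-*-rawRing -Raw-AlmostCommutative⟶ fromCommutativeRing R
  homomorphism = record
    { ⟦_⟧ = fromℤ ; +-homo = fromℤ-+ ; *-homo = fromℤ-* ; -‿homo = fromℤ-neg ; 0-homo = ≈-refl ; 1-homo = ≈-refl }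

  open import Algebra.Solver.Ring ℤ.+-*-rawRing (fromCommutativeRing R) homomorphism
    (λ i j → Maybe.map (λ i≡j → reflexive (cong fromℤ i≡j)) (dec⇒maybe (i ℤ.≟ j))) public

module FieldProperties (F : Field) where
  open Field F public

  commutativeRing : CommutativeRing _ _
  commutativeRing = record { isCommutativeRing = isCommutativeRing }

  open CommutativeRing commutativeRing public
    using (_-_; +-assoc; +-comm; *-assoc; *-comm; +-identityˡ; +-identityʳ; *-identityˡ; *-identityʳ;
           distribˡ; distribʳ; -‿inverseˡ; -‿inverseʳ; zeroˡ; zeroʳ; ring; +-group)
  open import Algebra.Properties.Ring ring public using (-‿distribˡ-*; -‿distribʳ-*; x+x≈x⇒x≈0)
  open import Algebra.Properties.Group +-group public
    using (⁻¹-involutive; ε⁻¹≈ε; inverseˡ-unique; x∙y⁻¹≈ε⇒x≈y; x≈y⇒x∙y⁻¹≈ε)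

  1≢0 : 1# ≢ 0#
  1≢0 = 0≢1 ∘ sym

  inv : (x : Carrier) → x ≢ 0# → Carrier
  inv x x≢0 = proj₁ (inverse x x≢0)

  *-inverseʳ : ∀ x (x≢0 : x ≢ 0#) → x * inv x x≢0 ≡ 1#
  *-inverseʳ x x≢0 = proj₂ (inverse x x≢0)

  *-inverseˡ : ∀ x (x≢0 : x ≢ 0#) → inv x x≢0 * x ≡ 1#
  *-inverseˡ x x≢0 = trans (*-comm _ _) (*-inverseʳ x x≢0)

  *-cancelˡ : ∀ {a x y} → a ≢ 0# → a * x ≡ a * y → x ≡ y
  *-cancelˡ {a} {x} {y} a≢0 ax≡ay = begin
    x                  ≡⟨ sym (*-identityˡ x) ⟩
    1# * x             ≡⟨ cong (_* x) (sym (*-inverseˡ a a≢0)) ⟩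
    (inv a a≢0 * a) * x ≡⟨ *-assoc _ _ _ ⟩
    inv a a≢0 * (a * x) ≡⟨ cong (inv a a≢0 *_) ax≡ay ⟩
    inv a a≢0 * (a * y) ≡⟨ sym (*-assoc _ _ _) ⟩
    (inv a a≢0 * a) * y ≡⟨ cong (_* y) (*-inverseˡ a a≢0) ⟩
    1# * y             ≡⟨ *-identityˡ y ⟩
    y                  ∎
    where open ≡-Reasoning

  *-cancelʳ : ∀ {a x y} → a ≢ 0# → x * a ≡ y * a → x ≡ y
  *-cancelʳ {a} {x} {y} a≢0 xa≡ya = *-cancelˡ a≢0 (trans (*-comm a x) (trans xa≡ya (*-comm y a)))

  *≡0⇒≡0 : ∀ {a b} → a ≢ 0# → a * b ≡ 0# → b ≡ 0#
  *≡0⇒≡0 {a} a≢0 ab≡0 = *-cancelˡ a≢0 (trans ab≡0 (sym (zeroʳ a)))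

  *-≢0 : ∀ {a b} → a ≢ 0# → b ≢ 0# → a * b ≢ 0#
  *-≢0 a≢0 b≢0 = b≢0 ∘ *≡0⇒≡0 a≢0

  inv-≢0 : ∀ x (x≢0 : x ≢ 0#) → inv x x≢0 ≢ 0#
  inv-≢0 x x≢0 inv≡0 = 1≢0 (trans (sym (*-inverseʳ x x≢0)) (trans (cong (x *_) inv≡0) (zeroʳ x)))

module Finite {A : Set} {n} (A↔Fin : A ↔ Fin n) where
  open Inverse A↔Fin

  infix 4 _≟_
  _≟_ : DecidableEquality A
  _≟_ = via-injection (↔⇒↣ A↔Fin) Fin._≟_

  all? : {P : A → Set} → (∀ x → Dec (P x)) → Dec (∀ x → P x)
  all? {P} P? = map′ (λ ∀P x → subst P (strictlyInverseʳ x) (∀P (to x))) (λ ∀P → ∀P ∘ from)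
                     (Fin.all? (P? ∘ from))

  any? : {P : A → Set} → (∀ x → Dec (P x)) → Dec (∃ P)
  any? {P} P? = map′ (λ { (i , p) → from i , p }) (λ { (x , p) → to x , subst P (sym (strictlyInverseʳ x)) p })
                     (Fin.any? (P? ∘ from))

module Plane (F : Field) (_≟_ : DecidableEquality (Field.Carrier F)) where
  open FieldProperties F
  open ℤ-Solver commutativeRing using (solve; _:+_; _:*_; _:-_; :-_; _:=_; con)

  L² : Set
  L² = Carrier × Carrier

  infixl 7 _*ᵥ_
  infixl 6 _+ᵥ_

  _*ᵥ_ : L² → Carrier → L²
  (u₁ , u₂) *ᵥ x = u₁ * x , u₂ * x

  _+ᵥ_ : L² → L² → L²
  (u₁ , u₂) +ᵥ (w₁ , w₂) = u₁ + w₁ , u₂ + w₂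

  0ᵥ : L²
  0ᵥ = 0# , 0#

  ≢0ᵥ⁺ : ∀ {u₁ u₂} → ¬ (u₁ ≡ 0# × u₂ ≡ 0#) → (u₁ , u₂) ≢ 0ᵥ
  ≢0ᵥ⁺ ¬both0 refl = ¬both0 (refl , refl)

  ≢0ᵥ⁻ : ∀ {u₁ u₂} → (u₁ , u₂) ≢ 0ᵥ → ¬ (u₁ ≡ 0# × u₂ ≡ 0#)
  ≢0ᵥ⁻ u≢0 (refl , refl) = u≢0 refl

  det : L² → L² → Carrier
  det (u₁ , u₂) (w₁ , w₂) = u₁ * w₂ - u₂ * w₁

  *ᵥ-assoc : ∀ u a b → u *ᵥ a *ᵥ b ≡ u *ᵥ (a * b)
  *ᵥ-assoc u a b = cong₂ _,_ (*-assoc _ a b) (*-assoc _ a b)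

  *ᵥ-identityʳ : ∀ u → u *ᵥ 1# ≡ u
  *ᵥ-identityʳ u = cong₂ _,_ (*-identityʳ _) (*-identityʳ _)

  *ᵥ-zeroʳ : ∀ u → u *ᵥ 0# ≡ 0ᵥ
  *ᵥ-zeroʳ u = cong₂ _,_ (zeroʳ _) (zeroʳ _)

  *ᵥ-distribʳ : ∀ u w c d x → (u *ᵥ c +ᵥ w *ᵥ d) *ᵥ x ≡ u *ᵥ (c * x) +ᵥ w *ᵥ (d * x)
  *ᵥ-distribʳ (u₁ , u₂) (w₁ , w₂) c d x = cong₂ _,_ (lemma u₁ w₁ c d x) (lemma u₂ w₂ c d x)
    where
    lemma : ∀ a b c d x → (a * c + b * d) * x ≡ a * (c * x) + b * (d * x)
    lemma = solve 5 (λ a b c d x → (a :* c :+ b :* d) :* x := a :* (c :* x) :+ b :* (d :* x)) refl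

  *ᵥ-zeroˡ : ∀ x → 0ᵥ *ᵥ x ≡ 0ᵥ
  *ᵥ-zeroˡ x = cong₂ _,_ (zeroˡ x) (zeroˡ x)

  det-*ᵥ : ∀ u w a b → det (u *ᵥ a) (w *ᵥ b) ≡ (a * b) * det u w
  det-*ᵥ (u₁ , u₂) (w₁ , w₂) = solve 6
    (λ u₁ u₂ w₁ w₂ a b → (u₁ :* a) :* (w₂ :* b) :- (u₂ :* a) :* (w₁ :* b) := (a :* b) :* (u₁ :* w₂ :- u₂ :* w₁))
    refl u₁ u₂ w₁ w₂

  det-*ᵥ-self : ∀ u y → det u (u *ᵥ y) ≡ 0#
  det-*ᵥ-self (u₁ , u₂) = solve 3 (λ u₁ u₂ y → u₁ :* (u₂ :* y) :- u₂ :* (u₁ :* y) := con (ℤ.+ 0)) refl u₁ u₂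

  det-antisym : ∀ u w → det u w ≡ - det w u
  det-antisym (u₁ , u₂) (w₁ , w₂) =
    solve 4 (λ u₁ u₂ w₁ w₂ → u₁ :* w₂ :- u₂ :* w₁ := :- (w₁ :* u₂ :- w₂ :* u₁)) refl u₁ u₂ w₁ w₂

  *ᵥ-cancelˡ : ∀ {u x y} → u ≢ 0ᵥ → u *ᵥ x ≡ u *ᵥ y → x ≡ y
  *ᵥ-cancelˡ {u₁ , u₂} u≢0 ux≡uy with u₁ ≟ 0# | u₂ ≟ 0#
  ... | no u₁≢0 | _        = *-cancelˡ u₁≢0 (cong proj₁ ux≡uy)
  ... | yes _   | no u₂≢0  = *-cancelˡ u₂≢0 (cong proj₂ ux≡uy)
  ... | yes u₁≡0 | yes u₂≡0 = ⊥-elim (≢0ᵥ⁻ u≢0 (u₁≡0 , u₂≡0))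

  private
    cross-ratio : ∀ {a b x y} (a≢0 : a ≢ 0#) → a * y ≡ b * x →
                  x ≡ a * (x * inv a a≢0) × y ≡ b * (x * inv a a≢0)
    cross-ratio {a} {b} {x} {y} a≢0 ay≡bx = sym x≡aκ , *-cancelˡ a≢0 (begin
        a * y             ≡⟨ ay≡bx ⟩
        b * x             ≡⟨ cong (b *_) (sym x≡aκ) ⟩
        b * (a * κ)       ≡⟨ solve 3 (λ a b κ → b :* (a :* κ) := a :* (b :* κ)) refl a b κ ⟩
        a * (b * κ)       ∎)
      where
      open ≡-Reasoning
      κ = x * inv a a≢0
      x≡aκ : a * κ ≡ x
      x≡aκ = begin
        a * (x * inv a a≢0) ≡⟨ solve 3 (λ a x i → a :* (x :* i) := x :* (a :* i)) refl a x (inv a a≢0) ⟩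
        x * (a * inv a a≢0) ≡⟨ cong (x *_) (*-inverseʳ a a≢0) ⟩
        x * 1#              ≡⟨ *-identityʳ x ⟩
        x                   ∎

  det≡0⇒proportional : ∀ {u w} → u ≢ 0ᵥ → det u w ≡ 0# → ∃[ κ ] w ≡ u *ᵥ κ
  det≡0⇒proportional {u₁ , u₂} {w₁ , w₂} u≢0 det≡0 with u₁ ≟ 0# | u₂ ≟ 0#
  ... | no u₁≢0 | _ =
    let w₁≡ , w₂≡ = cross-ratio u₁≢0 (x∙y⁻¹≈ε⇒x≈y _ _ det≡0) in _ , cong₂ _,_ w₁≡ w₂≡
  ... | yes _ | no u₂≢0 =
    let w₂≡ , w₁≡ = cross-ratio u₂≢0 (sym (x∙y⁻¹≈ε⇒x≈y _ _ det≡0)) in _ , cong₂ _,_ w₁≡ w₂≡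
  ... | yes u₁≡0 | yes u₂≡0 = ⊥-elim (≢0ᵥ⁻ u≢0 (u₁≡0 , u₂≡0))

  module Basis (U₁ U₂ : L²) (Δ≢0 : det U₁ U₂ ≢ 0#) where
    Δ : Carrier
    Δ = det U₁ U₂

    coord₁ coord₂ : L² → Carrier
    coord₁ p = det p U₂ * inv Δ Δ≢0
    coord₂ p = det U₁ p * inv Δ Δ≢0

    det-combination : ∀ c d c' d' → det (U₁ *ᵥ c +ᵥ U₂ *ᵥ d) (U₁ *ᵥ c' +ᵥ U₂ *ᵥ d') ≡ (c * d' - d * c') * Δ
    det-combination c d c' d' = solve 8
      (λ a₁ a₂ b₁ b₂ c d c' d' →
        (a₁ :* c :+ b₁ :* d) :* (a₂ :* c' :+ b₂ :* d') :- (a₂ :* c :+ b₂ :* d) :* (a₁ :* c' :+ b₁ :* d')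
          := (c :* d' :- d :* c') :* (a₁ :* b₂ :- a₂ :* b₁))
      refl (proj₁ U₁) (proj₂ U₁) (proj₁ U₂) (proj₂ U₂) c d c' d'

    decompose : ∀ p → p ≡ U₁ *ᵥ coord₁ p +ᵥ U₂ *ᵥ coord₂ p
    decompose (p₁ , p₂) = sym (cong₂ _,_
        (trans (solve 7 (λ a₁ a₂ b₁ b₂ p₁ p₂ i →
                  a₁ :* ((p₁ :* b₂ :- p₂ :* b₁) :* i) :+ b₁ :* ((a₁ :* p₂ :- a₂ :* p₁) :* i)
                    := p₁ :* ((a₁ :* b₂ :- a₂ :* b₁) :* i)) refl a₁ a₂ b₁ b₂ p₁ p₂ i)
               (cancel-Δ p₁))
        (trans (solve 7 (λ a₁ a₂ b₁ b₂ p₁ p₂ i →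
                  a₂ :* ((p₁ :* b₂ :- p₂ :* b₁) :* i) :+ b₂ :* ((a₁ :* p₂ :- a₂ :* p₁) :* i)
                    := p₂ :* ((a₁ :* b₂ :- a₂ :* b₁) :* i)) refl a₁ a₂ b₁ b₂ p₁ p₂ i)
               (cancel-Δ p₂)))
      where
      a₁ = proj₁ U₁
      a₂ = proj₂ U₁
      b₁ = proj₁ U₂
      b₂ = proj₂ U₂
      i = inv Δ Δ≢0
      cancel-Δ : ∀ p → p * (Δ * i) ≡ p
      cancel-Δ p = trans (cong (p *_) (*-inverseʳ Δ Δ≢0)) (*-identityʳ p)

    coordinates-unique : ∀ {c d c' d'} → U₁ *ᵥ c +ᵥ U₂ *ᵥ d ≡ U₁ *ᵥ c' +ᵥ U₂ *ᵥ d' → c ≡ c' × d ≡ d'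
    coordinates-unique {c} {d} {c'} {d'} eq =
        *-cancelʳ Δ≢0 (trans (sym (det-U₂ c d)) (trans (cong (λ p → det p U₂) eq) (det-U₂ c' d'))) ,
        *-cancelʳ Δ≢0 (trans (sym (det-U₁ c d)) (trans (cong (det U₁) eq) (det-U₁ c' d')))
      where
      a₁ = proj₁ U₁
      a₂ = proj₂ U₁
      b₁ = proj₁ U₂
      b₂ = proj₂ U₂
      det-U₂ : ∀ c d → det (U₁ *ᵥ c +ᵥ U₂ *ᵥ d) U₂ ≡ c * Δ
      det-U₂ c d = solve 6 (λ a₁ a₂ b₁ b₂ c d →
        (a₁ :* c :+ b₁ :* d) :* b₂ :- (a₂ :* c :+ b₂ :* d) :* b₁ := c :* (a₁ :* b₂ :- a₂ :* b₁)) refl a₁ a₂ b₁ b₂ c d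
      det-U₁ : ∀ c d → det U₁ (U₁ *ᵥ c +ᵥ U₂ *ᵥ d) ≡ d * Δ
      det-U₁ c d = solve 6 (λ a₁ a₂ b₁ b₂ c d →
        a₁ :* (a₂ :* c :+ b₂ :* d) :- a₂ :* (a₁ :* c :+ b₁ :* d) := d :* (a₁ :* b₂ :- a₂ :* b₁)) refl a₁ a₂ b₁ b₂ c d

    det-coordinates : ∀ p p' → det p p' ≡ (coord₁ p * coord₂ p' - coord₂ p * coord₁ p') * Δ
    det-coordinates p p' = trans (cong₂ det (decompose p) (decompose p')) (det-combination _ _ _ _)

module ChainGeometry {q t} (FE : FieldExt q t) where
  open FieldExt FE using (L; inK; cardL)
  open FieldProperties L
  open Finite cardL public using (_≟_)
  open Plane L _≟_ public
  open Chains FE public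
  open ℤ-Solver commutativeRing using (solve; _:+_; _:*_; _:=_)

  linear-0 : ∀ {f} → IsLinear f → f 0# ≡ 0#
  linear-0 {f} (f-+ , _) = x+x≈x⇒x≈0 (f 0#) (trans (sym (f-+ 0# 0#)) (cong f (+-identityʳ 0#)))

  linear-neg : ∀ {f} → IsLinear f → ∀ x → f (- x) ≡ - f x
  linear-neg {f} f-lin@(f-+ , _) x = inverseˡ-unique (f (- x)) (f x) (begin
    f (- x) + f x    ≡⟨ f-+ (- x) x ⟨
    f (- x + x)      ≡⟨ cong f (-‿inverseˡ x) ⟩
    f 0#             ≡⟨ linear-0 f-lin ⟩
    0#               ∎)
    where open ≡-Reasoning

  ·ₑ-linear : ∀ {f g} → IsLinear f → IsLinear g → IsLinear (f ·ₑ g)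
  ·ₑ-linear {f} {g} (f-+ , f-* ) (g-+ , g-*) =
    (λ x y → trans (cong g (f-+ x y)) (g-+ _ _)) ,
    (λ c x c∈K → trans (cong g (f-* c x c∈K)) (g-* c _ c∈K))

  1ₑ-linear : IsLinear 1ₑ
  1ₑ-linear = (λ _ _ → refl) , (λ _ _ _ → refl)

  ρ-linear : ∀ a → IsLinear (ρ a)
  ρ-linear a = distribˡ a , λ c x _ → solve 3 (λ a c x → a :* (c :* x) := c :* (a :* x)) refl a c x

  record IsLinearBijection (ζ : Map) : Set where
    field
      linear : IsLinear ζ
      ζ⁻¹ : Map
      inverseˡ : ∀ x → ζ⁻¹ (ζ x) ≡ x
      inverseʳ : ∀ y → ζ (ζ⁻¹ y) ≡ y

    ζ⁻¹-linear : IsLinear ζ⁻¹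
    ζ⁻¹-linear =
      (λ x y → trans (cong ζ⁻¹ (cong₂ _+_ (sym (inverseʳ x)) (sym (inverseʳ y))))
               (trans (cong ζ⁻¹ (sym (proj₁ linear (ζ⁻¹ x) (ζ⁻¹ y)))) (inverseˡ _))) ,
      (λ c x c∈K → trans (cong (λ y → ζ⁻¹ (c * y)) (sym (inverseʳ x)))
               (trans (cong ζ⁻¹ (sym (proj₂ linear c (ζ⁻¹ x) c∈K))) (inverseˡ _)))

    ζ≡0⇒≡0 : ∀ {x} → ζ x ≡ 0# → x ≡ 0#
    ζ≡0⇒≡0 {x} ζx≡0 = begin
      x           ≡⟨ inverseˡ x ⟨
      ζ⁻¹ (ζ x)   ≡⟨ cong ζ⁻¹ (trans ζx≡0 (sym (linear-0 linear))) ⟩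
      ζ⁻¹ (ζ 0#)  ≡⟨ inverseˡ 0# ⟩
      0#          ∎
      where open ≡-Reasoning

  infixl 7 _⋆ₗ_
  _⋆ₗ_ : L² → Mat → L²
  (p₁ , p₂) ⋆ₗ mat a b c d = a p₁ + c p₂ , b p₁ + d p₂

  _at_ : Pair → Carrier → L²
  (α , β) at x = α x , β x

  -- chainPoint M u at x reduces to (u *ᵥ x) ⋆ₗ M, which turns statements about E into ones about L²
  chainPoint : Mat → L² → Pair
  chainPoint M (u₁ , u₂) = (ρ u₁ , ρ u₂) ⋆ M

  private
    +-interchange : ∀ a b c d → (a + b) + (c + d) ≡ (a + c) + (b + d)
    +-interchange = solve 4 (λ a b c d → (a :+ b) :+ (c :+ d) := (a :+ c) :+ (b :+ d)) refl

  ⋆ₗ-+ᵥ : ∀ {M} → IsLinearMat M → ∀ p p' → (p +ᵥ p') ⋆ₗ M ≡ p ⋆ₗ M +ᵥ p' ⋆ₗ M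
  ⋆ₗ-+ᵥ {mat a b c d} (a-lin , b-lin , c-lin , d-lin) p p' = cong₂ _,_
    (trans (cong₂ _+_ (proj₁ a-lin _ _) (proj₁ c-lin _ _)) (+-interchange _ _ _ _))
    (trans (cong₂ _+_ (proj₁ b-lin _ _) (proj₁ d-lin _ _)) (+-interchange _ _ _ _))

  0ᵥ-⋆ₗ : ∀ {M} → IsLinearMat M → 0ᵥ ⋆ₗ M ≡ 0ᵥ
  0ᵥ-⋆ₗ {mat a b c d} (a-lin , b-lin , c-lin , d-lin) = cong₂ _,_
    (trans (cong₂ _+_ (linear-0 a-lin) (linear-0 c-lin)) (+-identityˡ 0#))
    (trans (cong₂ _+_ (linear-0 b-lin) (linear-0 d-lin)) (+-identityˡ 0#))

  ⋆ₗ-inverse : ∀ {M N} → IsLinearMat N → (M ·ₘ N) ≈ₘ Iₘ → ∀ p → p ⋆ₗ M ⋆ₗ N ≡ p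
  ⋆ₗ-inverse {mat a b c d} {mat a' b' c' d'} (a'-lin , b'-lin , c'-lin , d'-lin) (e₁₁ , e₁₂ , e₂₁ , e₂₂) (y , z) =
    cong₂ _,_
      (begin
        a' (a y + c z) + c' (b y + d z)                  ≡⟨ cong₂ _+_ (proj₁ a'-lin _ _) (proj₁ c'-lin _ _) ⟩
        (a' (a y) + a' (c z)) + (c' (b y) + c' (d z))    ≡⟨ +-interchange _ _ _ _ ⟩
        (a' (a y) + c' (b y)) + (a' (c z) + c' (d z))    ≡⟨ cong₂ _+_ (e₁₁ y) (e₂₁ z) ⟩
        y + 0#                                           ≡⟨ +-identityʳ y ⟩
        y                                                ∎)
      (begin
        b' (a y + c z) + d' (b y + d z)                  ≡⟨ cong₂ _+_ (proj₁ b'-lin _ _) (proj₁ d'-lin _ _) ⟩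
        (b' (a y) + b' (c z)) + (d' (b y) + d' (d z))    ≡⟨ +-interchange _ _ _ _ ⟩
        (b' (a y) + d' (b y)) + (b' (c z) + d' (d z))    ≡⟨ cong₂ _+_ (e₁₂ y) (e₂₂ z) ⟩
        0# + z                                           ≡⟨ +-identityˡ z ⟩
        z                                                ∎)
    where open ≡-Reasoning

  ⋆ₗ-injective : ∀ {M N} → IsLinearMat N → (M ·ₘ N) ≈ₘ Iₘ → ∀ {p p'} → p ⋆ₗ M ≡ p' ⋆ₗ M → p ≡ p'
  ⋆ₗ-injective {N = N} N-linear MN≈I {p} {p'} pM≡p'M =
    trans (sym (⋆ₗ-inverse N-linear MN≈I p)) (trans (cong (_⋆ₗ N) pM≡p'M) (⋆ₗ-inverse N-linear MN≈I p'))

  infix 4 _∼_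
  _∼_ : Pair → Pair → Set
  v ∼ w = v ∈E w × w ∈E v

  ∼⇒SameSub : ∀ {v w} → v ∼ w → SameSub v w
  ∼⇒SameSub ((g , g-lin , v≈gw) , (g' , g'-lin , w≈g'v)) =
    (λ ξ ξ-lin → ξ ·ₑ g , ·ₑ-linear ξ-lin g-lin , (λ x → proj₁ v≈gw (ξ x)) , (λ x → proj₂ v≈gw (ξ x))) ,
    (λ ξ ξ-lin → ξ ·ₑ g' , ·ₑ-linear ξ-lin g'-lin , (λ x → proj₁ w≈g'v (ξ x)) , (λ x → proj₂ w≈g'v (ξ x)))

  SameSub⇒∼ : ∀ {v w} → SameSub v w → v ∼ w
  SameSub⇒∼ {v} {w} (v⊆w , w⊆v) = v⊆w 1ₑ 1ₑ-linear , w⊆v 1ₑ 1ₑ-linear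

  ∼-sym : ∀ {v w} → v ∼ w → w ∼ v
  ∼-sym (v∈w , w∈v) = w∈v , v∈w

  ∈E-trans : ∀ {u v w} → u ∈E v → v ∈E w → u ∈E w
  ∈E-trans (g , g-lin , u≈gv) (h , h-lin , v≈hw) =
    g ·ₑ h , ·ₑ-linear g-lin h-lin ,
    (λ x → trans (proj₁ u≈gv x) (proj₁ v≈hw (g x))) , (λ x → trans (proj₂ u≈gv x) (proj₂ v≈hw (g x)))

  ∼-trans : ∀ {u v w} → u ∼ v → v ∼ w → u ∼ w
  ∼-trans {u} {v} {w} (u∈v , v∈u) (v∈w , w∈v) = ∈E-trans {u} {v} {w} u∈v v∈w , ∈E-trans {w} {v} {u} w∈v v∈u

  chainPoint-∈E : ∀ M {u u' g} → IsLinear g → (∀ x → u *ᵥ x ≡ u' *ᵥ g x) → chainPoint M u ∈E chainPoint M u'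
  chainPoint-∈E M {g = g} g-lin ux≡u'gx =
    g , g-lin , (λ x → cong proj₁ (same-image x)) , (λ x → cong proj₂ (same-image x))
    where
    same-image : ∀ x → chainPoint M _ at x ≡ chainPoint M _ at g x
    same-image x = cong (_⋆ₗ M) (ux≡u'gx x)

  chainPoint-*ᵥ : ∀ M u {κ} → κ ≢ 0# → chainPoint M u ∼ chainPoint M (u *ᵥ κ)
  chainPoint-*ᵥ M u {κ} κ≢0 =
    chainPoint-∈E M (ρ-linear κ⁻¹) (λ x → sym (begin
      u *ᵥ κ *ᵥ (κ⁻¹ * x)  ≡⟨ *ᵥ-assoc u κ _ ⟩
      u *ᵥ (κ * (κ⁻¹ * x)) ≡⟨ cong (u *ᵥ_) (trans (sym (*-assoc κ κ⁻¹ x)) (cong (_* x) (*-inverseʳ κ κ≢0))) ⟩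
      u *ᵥ (1# * x)        ≡⟨ cong (u *ᵥ_) (*-identityˡ x) ⟩
      u *ᵥ x               ∎)) ,
    chainPoint-∈E M (ρ-linear κ) (*ᵥ-assoc u κ)
    where
    open ≡-Reasoning
    κ⁻¹ = inv κ κ≢0

  independent-points : ∀ M {v v' u u'} → u ≢ 0ᵥ → u' ≢ 0ᵥ → v ∼ chainPoint M u → v' ∼ chainPoint M u' →
                       ¬ SameSub v v' → det u u' ≢ 0#
  independent-points M {u = u} u≢0 u'≢0 v∼u v'∼u' v≁v' det≡0 with det≡0⇒proportional u≢0 det≡0
  ... | κ , refl = v≁v' (∼⇒SameSub (∼-trans v∼u (∼-trans (chainPoint-*ᵥ M u κ≢0) (∼-sym v'∼u'))))
    where
    κ≢0 : κ ≢ 0#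
    κ≢0 κ≡0 = u'≢0 (trans (cong (u *ᵥ_) κ≡0) (*ᵥ-zeroʳ u))

module TwoChains {q t} (FE : FieldExt q t) (M₁ M₂ : Chains.Mat FE)
                 (M₁∈GL₂ : Chains.InGL2 FE M₁) (M₂∈GL₂ : Chains.InGL2 FE M₂) where
  open FieldExt FE using (L)
  open FieldProperties L
  open ChainGeometry FE public

  private
    M₁-linear = proj₁ M₁∈GL₂
    M₂-linear = proj₁ M₂∈GL₂
    N₂ = proj₁ (proj₂ M₂∈GL₂)
    N₂-linear = proj₁ (proj₂ (proj₂ M₂∈GL₂))

    ⋆ₗM₁-injective : ∀ {p p'} → p ⋆ₗ M₁ ≡ p' ⋆ₗ M₁ → p ≡ p'
    ⋆ₗM₁-injective = ⋆ₗ-injective (proj₁ (proj₂ (proj₂ M₁∈GL₂))) (proj₁ (proj₂ (proj₂ (proj₂ M₁∈GL₂))))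

    ⋆ₗM₂-injective : ∀ {p p'} → p ⋆ₗ M₂ ≡ p' ⋆ₗ M₂ → p ≡ p'
    ⋆ₗM₂-injective = ⋆ₗ-injective N₂-linear (proj₁ (proj₂ (proj₂ (proj₂ M₂∈GL₂))))

    N₂M₂ : ∀ p → p ⋆ₗ N₂ ⋆ₗ M₂ ≡ p
    N₂M₂ = ⋆ₗ-inverse M₂-linear (proj₂ (proj₂ (proj₂ (proj₂ M₂∈GL₂))))

  ψ : L² → L²
  ψ p = p ⋆ₗ M₁ ⋆ₗ N₂

  ψ-⋆ₗM₂ : ∀ p → ψ p ⋆ₗ M₂ ≡ p ⋆ₗ M₁
  ψ-⋆ₗM₂ p = N₂M₂ (p ⋆ₗ M₁)

  ψ-injective : ∀ {p p'} → ψ p ≡ ψ p' → p ≡ p'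
  ψ-injective {p} {p'} ψp≡ψp' =
    ⋆ₗM₁-injective (trans (sym (ψ-⋆ₗM₂ p)) (trans (cong (_⋆ₗ M₂) ψp≡ψp') (ψ-⋆ₗM₂ p')))

  ψ-+ᵥ : ∀ p p' → ψ (p +ᵥ p') ≡ ψ p +ᵥ ψ p'
  ψ-+ᵥ p p' = trans (cong (_⋆ₗ N₂) (⋆ₗ-+ᵥ M₁-linear p p')) (⋆ₗ-+ᵥ N₂-linear _ _)

  ψ-0ᵥ : ψ 0ᵥ ≡ 0ᵥ
  ψ-0ᵥ = trans (cong (_⋆ₗ N₂) (0ᵥ-⋆ₗ M₁-linear)) (0ᵥ-⋆ₗ N₂-linear)

  ψ≡0ᵥ⇒≡0ᵥ : ∀ {p} → ψ p ≡ 0ᵥ → p ≡ 0ᵥ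
  ψ≡0ᵥ⇒≡0ᵥ ψp≡0 = ψ-injective (trans ψp≡0 (sym ψ-0ᵥ))

  record Corresponds (u w : L²) : Set where
    field
      ζ : Map
      ζ-bijective : IsLinearBijection ζ
      ψ-*ᵥ : ∀ x → ψ (u *ᵥ x) ≡ w *ᵥ ζ x

  target-≢0ᵥ : ∀ {u w} {ζ : Map} → u ≢ 0ᵥ → (∀ x → ψ (u *ᵥ x) ≡ w *ᵥ ζ x) → w ≢ 0ᵥ
  target-≢0ᵥ {u} {w} {ζ} u≢0 ψ-*ᵥ w≡0 = u≢0 (begin
    u                ≡⟨ *ᵥ-identityʳ u ⟨
    u *ᵥ 1#          ≡⟨ ψ≡0ᵥ⇒≡0ᵥ {u *ᵥ 1#} (trans (ψ-*ᵥ 1#) wζ1≡0ᵥ) ⟩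
    0ᵥ               ∎)
    where
    open ≡-Reasoning
    wζ1≡0ᵥ : w *ᵥ ζ 1# ≡ 0ᵥ
    wζ1≡0ᵥ = trans (cong (_*ᵥ ζ 1#) w≡0) (*ᵥ-zeroˡ (ζ 1#))

  source-≢0ᵥ : ∀ {u w} → w ≢ 0ᵥ → Corresponds u w → u ≢ 0ᵥ
  source-≢0ᵥ {u} {w} w≢0 record { ζ = ζ ; ζ-bijective = ζ-bij ; ψ-*ᵥ = ψ-*ᵥ } u≡0 = w≢0 (begin
    w                  ≡⟨ *ᵥ-identityʳ w ⟨
    w *ᵥ 1#            ≡⟨ cong (w *ᵥ_) (inverseʳ 1#) ⟨
    w *ᵥ ζ (ζ⁻¹ 1#)    ≡⟨ ψ-*ᵥ (ζ⁻¹ 1#) ⟨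
    ψ (u *ᵥ ζ⁻¹ 1#)    ≡⟨ cong (λ p → ψ (p *ᵥ ζ⁻¹ 1#)) u≡0 ⟩
    ψ (0ᵥ *ᵥ ζ⁻¹ 1#)   ≡⟨ cong ψ (*ᵥ-zeroˡ _) ⟩
    ψ 0ᵥ               ≡⟨ ψ-0ᵥ ⟩
    0ᵥ                 ∎)
    where
    open ≡-Reasoning
    open IsLinearBijection ζ-bij

  ∼⇒Corresponds : ∀ {u w} → u ≢ 0ᵥ → chainPoint M₁ u ∼ chainPoint M₂ w → Corresponds u w
  ∼⇒Corresponds {u} {w} u≢0 ((η , η-lin , u≈ηw) , (η' , _ , w≈η'u)) = record
    { ζ = η
    ; ζ-bijective = record { linear = η-lin ; ζ⁻¹ = η' ; inverseˡ = inverseˡ ; inverseʳ = inverseʳ }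
    ; ψ-*ᵥ = ψ-*ᵥ
    }
    where
    u⋆M₁ : ∀ x → u *ᵥ x ⋆ₗ M₁ ≡ w *ᵥ η x ⋆ₗ M₂
    u⋆M₁ x = cong₂ _,_ (proj₁ u≈ηw x) (proj₂ u≈ηw x)
    w⋆M₂ : ∀ y → w *ᵥ y ⋆ₗ M₂ ≡ u *ᵥ η' y ⋆ₗ M₁
    w⋆M₂ y = cong₂ _,_ (proj₁ w≈η'u y) (proj₂ w≈η'u y)
    ψ-*ᵥ : ∀ x → ψ (u *ᵥ x) ≡ w *ᵥ η x
    ψ-*ᵥ x = ⋆ₗM₂-injective (trans (ψ-⋆ₗM₂ _) (u⋆M₁ x))
    inverseˡ : ∀ x → η' (η x) ≡ x
    inverseˡ x = sym (*ᵥ-cancelˡ u≢0 (⋆ₗM₁-injective (trans (u⋆M₁ x) (w⋆M₂ (η x)))))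
    inverseʳ : ∀ y → η (η' y) ≡ y
    inverseʳ y = sym (*ᵥ-cancelˡ (target-≢0ᵥ {ζ = η} u≢0 ψ-*ᵥ) (⋆ₗM₂-injective (trans (w⋆M₂ y) (u⋆M₁ (η' y)))))

  Corresponds⇒∼ : ∀ {u w} → Corresponds u w → chainPoint M₁ u ∼ chainPoint M₂ w
  Corresponds⇒∼ {u} {w} record { ζ = ζ ; ζ-bijective = ζ-bij ; ψ-*ᵥ = ψ-*ᵥ } =
    (ζ , linear , (λ x → cong proj₁ (u⋆M₁ x)) , (λ x → cong proj₂ (u⋆M₁ x))) ,
    (ζ⁻¹ , ζ⁻¹-linear , (λ y → cong proj₁ (w⋆M₂ y)) , (λ y → cong proj₂ (w⋆M₂ y)))
    where
    open IsLinearBijection ζ-bij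
    u⋆M₁ : ∀ x → u *ᵥ x ⋆ₗ M₁ ≡ w *ᵥ ζ x ⋆ₗ M₂
    u⋆M₁ x = trans (sym (ψ-⋆ₗM₂ _)) (cong (_⋆ₗ M₂) (ψ-*ᵥ x))
    w⋆M₂ : ∀ y → w *ᵥ y ⋆ₗ M₂ ≡ u *ᵥ ζ⁻¹ y ⋆ₗ M₁
    w⋆M₂ y = trans (cong (λ z → w *ᵥ z ⋆ₗ M₂) (sym (inverseʳ y))) (sym (u⋆M₁ (ζ⁻¹ y)))

module FrameConstruction {q t} (FE : FieldExt q t) (M₁ M₂ : Chains.Mat FE)
                         (M₁∈GL₂ : Chains.InGL2 FE M₁) (M₂∈GL₂ : Chains.InGL2 FE M₂) where
  open FieldExt FE using (L; inK)
  open FieldProperties L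
  open TwoChains FE M₁ M₂ M₁∈GL₂ M₂∈GL₂ public
  open Corresponds

  record Frame : Set where
    field
      U₁ U₂ W₁ W₂ : L²
      det-U≢0 : det U₁ U₂ ≢ 0#
      det-W≢0 : det W₁ W₂ ≢ 0#
      f : Map
      f-bijective : IsLinearBijection f
      ψ-frame : ∀ c d → ψ (U₁ *ᵥ c +ᵥ U₂ *ᵥ d) ≡ W₁ *ᵥ f c +ᵥ W₂ *ᵥ f d

  corresponding-independent : ∀ {u₁ u₂ w₁ w₂} → u₁ ≢ 0ᵥ → Corresponds u₁ w₁ → Corresponds u₂ w₂ →
                              det u₁ u₂ ≢ 0# → det w₁ w₂ ≢ 0#
  corresponding-independent {u₁} {u₂} {w₁} {w₂} u₁≢0 C₁ C₂ det-u≢0 det-w≡0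
    with det≡0⇒proportional (target-≢0ᵥ {ζ = ζ C₁} u₁≢0 (ψ-*ᵥ C₁)) det-w≡0
  ... | κ , refl = det-u≢0 (trans (cong (det u₁) u₂≡u₁y) (det-*ᵥ-self u₁ y))
    where
    open IsLinearBijection (ζ-bijective C₁)
    open ≡-Reasoning
    y = ζ⁻¹ (κ * ζ C₂ 1#)
    u₂≡u₁y : u₂ ≡ u₁ *ᵥ y
    u₂≡u₁y = trans (sym (*ᵥ-identityʳ u₂)) (ψ-injective (begin
      ψ (u₂ *ᵥ 1#)         ≡⟨ ψ-*ᵥ C₂ 1# ⟩
      w₁ *ᵥ κ *ᵥ ζ C₂ 1#   ≡⟨ *ᵥ-assoc w₁ κ _ ⟩
      w₁ *ᵥ (κ * ζ C₂ 1#)  ≡⟨ cong (w₁ *ᵥ_) (inverseʳ _) ⟨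
      w₁ *ᵥ ζ C₁ y         ≡⟨ ψ-*ᵥ C₁ y ⟨
      ψ (u₁ *ᵥ y)          ∎))

  -- Rescaling u₁ and u₂ by the coordinates of u₃ makes all three correspondences share ζ of the third.
  module FromThreePoints {u₁ u₂ u₃ w₁ w₂ w₃} (u₁≢0 : u₁ ≢ 0ᵥ)
           (C₁ : Corresponds u₁ w₁) (C₂ : Corresponds u₂ w₂) (C₃ : Corresponds u₃ w₃)
           (det₁₂≢0 : det u₁ u₂ ≢ 0#) (det₁₃≢0 : det u₁ u₃ ≢ 0#) (det₂₃≢0 : det u₂ u₃ ≢ 0#) where

    private
      detʷ₁₂≢0 : det w₁ w₂ ≢ 0#
      detʷ₁₂≢0 = corresponding-independent u₁≢0 C₁ C₂ det₁₂≢0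
      module U = Basis u₁ u₂ det₁₂≢0
      module W = Basis w₁ w₂ detʷ₁₂≢0
      ζ₁ = ζ C₁
      ζ₂ = ζ C₂
      ζ₃ = ζ C₃

      λ₃ μ₃ α₃ β₃ : Carrier
      λ₃ = U.coord₁ u₃
      μ₃ = U.coord₂ u₃
      α₃ = W.coord₁ w₃
      β₃ = W.coord₂ w₃

      λ₃≢0 : λ₃ ≢ 0#
      λ₃≢0 = *-≢0 (λ det₃₂≡0 → det₂₃≢0 (trans (det-antisym u₂ u₃) (trans (cong -_ det₃₂≡0) ε⁻¹≈ε)))
                  (inv-≢0 _ det₁₂≢0)

      μ₃≢0 : μ₃ ≢ 0#
      μ₃≢0 = *-≢0 det₁₃≢0 (inv-≢0 _ det₁₂≢0)

      ζ-coordinates : ∀ x → ζ₁ (λ₃ * x) ≡ α₃ * ζ₃ x × ζ₂ (μ₃ * x) ≡ β₃ * ζ₃ x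
      ζ-coordinates x = W.coordinates-unique (begin
        w₁ *ᵥ ζ₁ (λ₃ * x) +ᵥ w₂ *ᵥ ζ₂ (μ₃ * x)       ≡⟨ cong₂ _+ᵥ_ (ψ-*ᵥ C₁ _) (ψ-*ᵥ C₂ _) ⟨
        ψ (u₁ *ᵥ (λ₃ * x)) +ᵥ ψ (u₂ *ᵥ (μ₃ * x))     ≡⟨ ψ-+ᵥ _ _ ⟨
        ψ (u₁ *ᵥ (λ₃ * x) +ᵥ u₂ *ᵥ (μ₃ * x))         ≡⟨ cong ψ (*ᵥ-distribʳ u₁ u₂ λ₃ μ₃ x) ⟨
        ψ ((u₁ *ᵥ λ₃ +ᵥ u₂ *ᵥ μ₃) *ᵥ x)              ≡⟨ cong (λ p → ψ (p *ᵥ x)) (U.decompose u₃) ⟨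
        ψ (u₃ *ᵥ x)                                  ≡⟨ ψ-*ᵥ C₃ x ⟩
        w₃ *ᵥ ζ₃ x                                   ≡⟨ cong (_*ᵥ ζ₃ x) (W.decompose w₃) ⟩
        (w₁ *ᵥ α₃ +ᵥ w₂ *ᵥ β₃) *ᵥ ζ₃ x               ≡⟨ *ᵥ-distribʳ w₁ w₂ α₃ β₃ _ ⟩
        w₁ *ᵥ (α₃ * ζ₃ x) +ᵥ w₂ *ᵥ (β₃ * ζ₃ x)       ∎)
        where open ≡-Reasoning

      α₃≢0 : α₃ ≢ 0#
      α₃≢0 α₃≡0 = λ₃≢0 (trans (sym (*-identityʳ λ₃)) (IsLinearBijection.ζ≡0⇒≡0 (ζ-bijective C₁)
        (trans (proj₁ (ζ-coordinates 1#)) (trans (cong (_* ζ₃ 1#) α₃≡0) (zeroˡ _)))))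

      β₃≢0 : β₃ ≢ 0#
      β₃≢0 β₃≡0 = μ₃≢0 (trans (sym (*-identityʳ μ₃)) (IsLinearBijection.ζ≡0⇒≡0 (ζ-bijective C₂)
        (trans (proj₂ (ζ-coordinates 1#)) (trans (cong (_* ζ₃ 1#) β₃≡0) (zeroˡ _)))))

      ψ-scaled : ∀ {u w} (C : Corresponds u w) {a b} → (∀ x → ζ C (a * x) ≡ b * ζ₃ x) →
                 ∀ x → ψ (u *ᵥ a *ᵥ x) ≡ w *ᵥ b *ᵥ ζ₃ x
      ψ-scaled {u} {w} C {a} {b} ζ-a x = begin
        ψ (u *ᵥ a *ᵥ x)      ≡⟨ cong ψ (*ᵥ-assoc u a x) ⟩
        ψ (u *ᵥ (a * x))     ≡⟨ ψ-*ᵥ C _ ⟩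
        w *ᵥ ζ C (a * x)     ≡⟨ cong (w *ᵥ_) (ζ-a x) ⟩
        w *ᵥ (b * ζ₃ x)      ≡⟨ *ᵥ-assoc w b _ ⟨
        w *ᵥ b *ᵥ ζ₃ x       ∎
        where open ≡-Reasoning

    frame : Frame
    frame = record
      { U₁ = u₁ *ᵥ λ₃ ; U₂ = u₂ *ᵥ μ₃ ; W₁ = w₁ *ᵥ α₃ ; W₂ = w₂ *ᵥ β₃
      ; det-U≢0 = λ det≡0 → *-≢0 (*-≢0 λ₃≢0 μ₃≢0) det₁₂≢0 (trans (sym (det-*ᵥ u₁ u₂ λ₃ μ₃)) det≡0)
      ; det-W≢0 = λ det≡0 → *-≢0 (*-≢0 α₃≢0 β₃≢0) detʷ₁₂≢0 (trans (sym (det-*ᵥ w₁ w₂ α₃ β₃)) det≡0)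
      ; f = ζ₃
      ; f-bijective = ζ-bijective C₃
      ; ψ-frame = λ c d → trans (ψ-+ᵥ _ _)
          (cong₂ _+ᵥ_ (ψ-scaled C₁ (proj₁ ∘ ζ-coordinates) c) (ψ-scaled C₂ (proj₂ ∘ ζ-coordinates) d))
      }

  module InFrame (Fr : Frame) where
    open Frame Fr public
    module U = Basis U₁ U₂ det-U≢0
    module W = Basis W₁ W₂ det-W≢0
    open IsLinearBijection f-bijective using (ζ≡0⇒≡0)
    open ℤ-Solver commutativeRing using (solve; _:*_; _:-_; _:=_; con)

    Multiplicative : Carrier → Set
    Multiplicative a = ∀ y → f (a * y) * f 1# ≡ f a * f y

    ψ-coordinates : ∀ u x → ψ (u *ᵥ x) ≡ W₁ *ᵥ f (U.coord₁ u * x) +ᵥ W₂ *ᵥ f (U.coord₂ u * x)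
    ψ-coordinates u x = begin
      ψ (u *ᵥ x)                                             ≡⟨ cong (λ p → ψ (p *ᵥ x)) (U.decompose u) ⟩
      ψ ((U₁ *ᵥ U.coord₁ u +ᵥ U₂ *ᵥ U.coord₂ u) *ᵥ x)        ≡⟨ cong ψ (*ᵥ-distribʳ U₁ U₂ _ _ x) ⟩
      ψ (U₁ *ᵥ (U.coord₁ u * x) +ᵥ U₂ *ᵥ (U.coord₂ u * x))   ≡⟨ ψ-frame _ _ ⟩
      W₁ *ᵥ f (U.coord₁ u * x) +ᵥ W₂ *ᵥ f (U.coord₂ u * x)   ∎
      where open ≡-Reasoning

    f-coordinates : ∀ {u w} (C : Corresponds u w) x →
                    f (U.coord₁ u * x) ≡ W.coord₁ w * ζ C x × f (U.coord₂ u * x) ≡ W.coord₂ w * ζ C x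
    f-coordinates {u} {w} C x = W.coordinates-unique (begin
      W₁ *ᵥ f (U.coord₁ u * x) +ᵥ W₂ *ᵥ f (U.coord₂ u * x)   ≡⟨ ψ-coordinates u x ⟨
      ψ (u *ᵥ x)                                             ≡⟨ ψ-*ᵥ C x ⟩
      w *ᵥ ζ C x                                             ≡⟨ cong (_*ᵥ ζ C x) (W.decompose w) ⟩
      (W₁ *ᵥ W.coord₁ w +ᵥ W₂ *ᵥ W.coord₂ w) *ᵥ ζ C x        ≡⟨ *ᵥ-distribʳ W₁ W₂ _ _ _ ⟩
      W₁ *ᵥ (W.coord₁ w * ζ C x) +ᵥ W₂ *ᵥ (W.coord₂ w * ζ C x) ∎)
      where open ≡-Reasoning

    slope : ∀ u → U.coord₁ u ≢ 0# → Carrier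
    slope u c≢0 = U.coord₂ u * inv (U.coord₁ u) c≢0

    -- f (c x) and f (d x) are the W-coordinates of w times the same ζ x, so f (d x) / f (c x) is constant
    slope-multiplicative : ∀ {u w} → Corresponds u w → (c≢0 : U.coord₁ u ≢ 0#) → Multiplicative (slope u c≢0)
    slope-multiplicative {u} {w} C c≢0 y = begin
      f (a * y) * f 1#                   ≡⟨ cong₂ (λ s s' → f s * f s') (*-assoc d c⁻¹ y) (sym (c-c⁻¹ 1#)) ⟩
      f (d * (c⁻¹ * y)) * f (c * (c⁻¹ * 1#)) ≡⟨ cong₂ _*_ (proj₂ (f-coordinates C _)) (proj₁ (f-coordinates C _)) ⟩
      (r * ζ C (c⁻¹ * y)) * (p * ζ C (c⁻¹ * 1#))
        ≡⟨ solve 4 (λ r a p b → (r :* a) :* (p :* b) := (r :* b) :* (p :* a)) refl r (ζ C (c⁻¹ * y)) p (ζ C (c⁻¹ * 1#)) ⟩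
      (r * ζ C (c⁻¹ * 1#)) * (p * ζ C (c⁻¹ * y)) ≡⟨ cong₂ _*_ (proj₂ (f-coordinates C _)) (proj₁ (f-coordinates C _)) ⟨
      f (d * (c⁻¹ * 1#)) * f (c * (c⁻¹ * y))
        ≡⟨ cong₂ (λ s s' → f s * f s') (trans (sym (*-assoc d c⁻¹ 1#)) (*-identityʳ a)) (c-c⁻¹ y) ⟩
      f a * f y                          ∎
      where
      open ≡-Reasoning
      c = U.coord₁ u
      d = U.coord₂ u
      c⁻¹ = inv c c≢0
      a = slope u c≢0
      p = W.coord₁ w
      r = W.coord₂ w
      c-c⁻¹ : ∀ y → c * (c⁻¹ * y) ≡ y
      c-c⁻¹ y = trans (sym (*-assoc c c⁻¹ y)) (trans (cong (_* y) (*-inverseʳ c c≢0)) (*-identityˡ y))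

    coord₁≡0⇒det≡0 : ∀ {u u'} → U.coord₁ u ≡ 0# → U.coord₁ u' ≡ 0# → det u u' ≡ 0#
    coord₁≡0⇒det≡0 {u} {u'} c≡0 c'≡0 = begin
      det u u'
        ≡⟨ U.det-coordinates u u' ⟩
      (U.coord₁ u * U.coord₂ u' - U.coord₂ u * U.coord₁ u') * U.Δ
        ≡⟨ cong₂ (λ s s' → (s * U.coord₂ u' - U.coord₂ u * s') * U.Δ) c≡0 c'≡0 ⟩
      (0# * U.coord₂ u' - U.coord₂ u * 0#) * U.Δ
        ≡⟨ solve 3 (λ d' d Δ → (con (ℤ.+ 0) :* d' :- d :* con (ℤ.+ 0)) :* Δ := con (ℤ.+ 0)) refl _ _ _ ⟩
      0# ∎
      where open ≡-Reasoning

    slope-injective : ∀ {u u'} (c≢0 : U.coord₁ u ≢ 0#) (c'≢0 : U.coord₁ u' ≢ 0#) →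
                      slope u c≢0 ≡ slope u' c'≢0 → det u u' ≡ 0#
    slope-injective {u} {u'} c≢0 c'≢0 slopes≡ = begin
      det u u'                           ≡⟨ U.det-coordinates u u' ⟩
      (c * d' - d * c') * U.Δ            ≡⟨ cong (_* U.Δ) (x≈y⇒x∙y⁻¹≈ε cd'≡dc') ⟩
      0# * U.Δ                           ≡⟨ zeroˡ _ ⟩
      0#                                 ∎
      where
      open ≡-Reasoning
      c = U.coord₁ u
      d = U.coord₂ u
      c' = U.coord₁ u'
      d' = U.coord₂ u'
      c⁻¹ = inv c c≢0
      c'⁻¹ = inv c' c'≢0
      cd'≡dc' : c * d' ≡ d * c'
      cd'≡dc' = begin
        c * d'                  ≡⟨ *-identityʳ _ ⟨
        (c * d') * 1#           ≡⟨ cong ((c * d') *_) (*-inverseʳ c' c'≢0) ⟨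
        (c * d') * (c' * c'⁻¹)
          ≡⟨ solve 4 (λ c d' c' i → (c :* d') :* (c' :* i) := (c :* c') :* (d' :* i)) refl c d' c' c'⁻¹ ⟩
        (c * c') * (d' * c'⁻¹)  ≡⟨ cong ((c * c') *_) slopes≡ ⟨
        (c * c') * (d * c⁻¹)
          ≡⟨ solve 4 (λ c d c' i → (c :* c') :* (d :* i) := (d :* c') :* (c :* i)) refl c d c' c⁻¹ ⟩
        (d * c') * (c * c⁻¹)    ≡⟨ cong ((d * c') *_) (*-inverseʳ c c≢0) ⟩
        (d * c') * 1#           ≡⟨ *-identityʳ _ ⟩
        d * c'                  ∎

    private
      f-linear = IsLinearBijection.linear f-bijective
      f-+ = proj₁ f-linear
      f-K = proj₂ f-linear

    f1≢0 : f 1# ≢ 0#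
    f1≢0 = 1≢0 ∘ ζ≡0⇒≡0

    multiplicative-0 : Multiplicative 0#
    multiplicative-0 y = begin
      f (0# * y) * f 1#   ≡⟨ cong (λ z → f z * f 1#) (zeroˡ y) ⟩
      f 0# * f 1#         ≡⟨ cong (_* f 1#) (linear-0 f-linear) ⟩
      0# * f 1#           ≡⟨ zeroˡ _ ⟩
      0#                  ≡⟨ zeroˡ _ ⟨
      0# * f y            ≡⟨ cong (_* f y) (linear-0 f-linear) ⟨
      f 0# * f y          ∎
      where open ≡-Reasoning

    multiplicative-K : ∀ c → inK c ≡ true → Multiplicative c
    multiplicative-K c c∈K y = begin
      f (c * y) * f 1#    ≡⟨ cong (_* f 1#) (f-K c y c∈K) ⟩
      (c * f y) * f 1#    ≡⟨ solve 3 (λ c a b → (c :* a) :* b := (c :* b) :* a) refl c (f y) (f 1#) ⟩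
      (c * f 1#) * f y    ≡⟨ cong (_* f y) (f-K c 1# c∈K) ⟨
      f (c * 1#) * f y    ≡⟨ cong (λ z → f z * f y) (*-identityʳ c) ⟩
      f c * f y           ∎
      where open ≡-Reasoning

    multiplicative-+ : ∀ {a b} → Multiplicative a → Multiplicative b → Multiplicative (a + b)
    multiplicative-+ {a} {b} mult-a mult-b y = begin
      f ((a + b) * y) * f 1#                 ≡⟨ cong (λ z → f z * f 1#) (distribʳ y a b) ⟩
      f (a * y + b * y) * f 1#               ≡⟨ cong (_* f 1#) (f-+ _ _) ⟩
      (f (a * y) + f (b * y)) * f 1#         ≡⟨ distribʳ _ _ _ ⟩
      f (a * y) * f 1# + f (b * y) * f 1#    ≡⟨ cong₂ _+_ (mult-a y) (mult-b y) ⟩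
      f a * f y + f b * f y                  ≡⟨ distribʳ _ _ _ ⟨
      (f a + f b) * f y                      ≡⟨ cong (_* f y) (f-+ a b) ⟨
      f (a + b) * f y                        ∎
      where open ≡-Reasoning

    multiplicative-neg : ∀ {a} → Multiplicative a → Multiplicative (- a)
    multiplicative-neg {a} mult-a y = begin
      f (- a * y) * f 1#      ≡⟨ cong (λ z → f z * f 1#) (-‿distribˡ-* a y) ⟨
      f (- (a * y)) * f 1#    ≡⟨ cong (_* f 1#) (linear-neg f-linear _) ⟩
      - f (a * y) * f 1#      ≡⟨ -‿distribˡ-* _ _ ⟨
      - (f (a * y) * f 1#)    ≡⟨ cong -_ (mult-a y) ⟩
      - (f a * f y)           ≡⟨ -‿distribˡ-* _ _ ⟩
      - f a * f y             ≡⟨ cong (_* f y) (linear-neg f-linear a) ⟨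
      f (- a) * f y           ∎
      where open ≡-Reasoning

    multiplicative-* : ∀ {a b} → Multiplicative a → Multiplicative b → Multiplicative (a * b)
    multiplicative-* {a} {b} mult-a mult-b y = *-cancelʳ f1≢0 (begin
      (f (a * b * y) * f 1#) * f 1#       ≡⟨ cong (λ z → (f z * f 1#) * f 1#) (*-assoc a b y) ⟩
      (f (a * (b * y)) * f 1#) * f 1#     ≡⟨ cong (_* f 1#) (mult-a (b * y)) ⟩
      (f a * f (b * y)) * f 1#            ≡⟨ *-assoc _ _ _ ⟩
      f a * (f (b * y) * f 1#)            ≡⟨ cong (f a *_) (mult-b y) ⟩
      f a * (f b * f y)                   ≡⟨ *-assoc _ _ _ ⟨
      (f a * f b) * f y                   ≡⟨ cong (_* f y) fab≡ ⟨
      (f (a * b) * f 1#) * f y            ≡⟨ solve 3 (λ a b c → (a :* b) :* c := (a :* c) :* b) refl (f (a * b)) (f 1#) (f y) ⟩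
      (f (a * b) * f y) * f 1#            ∎)
      where
      open ≡-Reasoning
      fab≡ : f (a * b) * f 1# ≡ f a * f b
      fab≡ = trans (cong (λ z → f z * f 1#) (sym (*-identityʳ (a * b))))
            (trans (cong (λ z → f z * f 1#) (*-assoc a b 1#))
            (trans (mult-a (b * 1#)) (cong (λ z → f a * f z) (*-identityʳ b))))

    multiplicative-inverse : ∀ {a b} → Multiplicative a → a * b ≡ 1# → Multiplicative b
    multiplicative-inverse {a} {b} mult-a ab≡1 y = *-cancelˡ fa≢0 (begin
      f a * (f (b * y) * f 1#)            ≡⟨ *-assoc _ _ _ ⟨
      (f a * f (b * y)) * f 1#            ≡⟨ cong (_* f 1#) (mult-a (b * y)) ⟨
      (f (a * (b * y)) * f 1#) * f 1#     ≡⟨ cong (λ z → (f z * f 1#) * f 1#) a[by]≡y ⟩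
      (f y * f 1#) * f 1#                 ≡⟨ solve 2 (λ a b → (a :* b) :* b := (b :* b) :* a) refl (f y) (f 1#) ⟩
      (f 1# * f 1#) * f y                 ≡⟨ cong (_* f y) (trans (cong (λ z → f z * f 1#) (sym ab≡1)) (mult-a b)) ⟩
      (f a * f b) * f y                   ≡⟨ *-assoc _ _ _ ⟩
      f a * (f b * f y)                   ∎)
      where
      open ≡-Reasoning
      a[by]≡y : a * (b * y) ≡ y
      a[by]≡y = trans (sym (*-assoc a b y)) (trans (cong (_* y) ab≡1) (*-identityˡ y))
      fa≢0 : f a ≢ 0#
      fa≢0 fa≡0 = 1≢0 (trans (sym ab≡1) (trans (cong (_* b) (ζ≡0⇒≡0 fa≡0)) (zeroˡ b)))

    module AllMultiplicative (multiplicative : ∀ a → Multiplicative a) where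
      private
        f1⁻¹ = inv (f 1#) f1≢0
        open IsLinearBijection f-bijective using (ζ⁻¹; inverseˡ; inverseʳ)

      g : Map
      g y = f y * f1⁻¹

      f-* : ∀ c y → f (c * y) ≡ f c * g y
      f-* c y = begin
        f (c * y)                    ≡⟨ *-identityʳ _ ⟨
        f (c * y) * 1#               ≡⟨ cong (f (c * y) *_) (*-inverseʳ _ f1≢0) ⟨
        f (c * y) * (f 1# * f1⁻¹)    ≡⟨ *-assoc _ _ _ ⟨
        (f (c * y) * f 1#) * f1⁻¹    ≡⟨ cong (_* f1⁻¹) (multiplicative c y) ⟩
        (f c * f y) * f1⁻¹           ≡⟨ *-assoc _ _ _ ⟩
        f c * g y                    ∎
        where open ≡-Reasoning

      g-bijective : IsLinearBijection g
      g-bijective = record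
        { linear = (λ x y → trans (cong (_* f1⁻¹) (f-+ x y)) (distribʳ _ _ _)) ,
                   (λ c x c∈K → trans (cong (_* f1⁻¹) (f-K c x c∈K)) (*-assoc _ _ _))
        ; ζ⁻¹ = λ y → ζ⁻¹ (y * f 1#)
        ; inverseˡ = λ x → trans (cong ζ⁻¹ (trans (*-assoc _ _ _) (trans (cong (f x *_) (*-inverseˡ _ f1≢0)) (*-identityʳ _))))
                                 (inverseˡ x)
        ; inverseʳ = λ y → trans (cong (_* f1⁻¹) (inverseʳ _))
                                 (trans (*-assoc _ _ _) (trans (cong (y *_) (*-inverseʳ _ f1≢0)) (*-identityʳ _)))
        }

      corresponds-forward : ∀ u → Corresponds u (W₁ *ᵥ f (U.coord₁ u) +ᵥ W₂ *ᵥ f (U.coord₂ u))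
      corresponds-forward u = record { ζ = g ; ζ-bijective = g-bijective ; ψ-*ᵥ = λ x → begin
        ψ (u *ᵥ x)                                                 ≡⟨ ψ-coordinates u x ⟩
        W₁ *ᵥ f (U.coord₁ u * x) +ᵥ W₂ *ᵥ f (U.coord₂ u * x)       ≡⟨ cong₂ (λ s s' → W₁ *ᵥ s +ᵥ W₂ *ᵥ s') (f-* _ x) (f-* _ x) ⟩
        W₁ *ᵥ (f (U.coord₁ u) * g x) +ᵥ W₂ *ᵥ (f (U.coord₂ u) * g x) ≡⟨ *ᵥ-distribʳ W₁ W₂ _ _ _ ⟨
        (W₁ *ᵥ f (U.coord₁ u) +ᵥ W₂ *ᵥ f (U.coord₂ u)) *ᵥ g x      ∎ }
        where open ≡-Reasoning

      corresponds-backward : ∀ w → Corresponds (U₁ *ᵥ ζ⁻¹ (W.coord₁ w) +ᵥ U₂ *ᵥ ζ⁻¹ (W.coord₂ w)) w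
      corresponds-backward w = record { ζ = g ; ζ-bijective = g-bijective ; ψ-*ᵥ = λ x → begin
        ψ ((U₁ *ᵥ c +ᵥ U₂ *ᵥ d) *ᵥ x)                  ≡⟨ cong ψ (*ᵥ-distribʳ U₁ U₂ c d x) ⟩
        ψ (U₁ *ᵥ (c * x) +ᵥ U₂ *ᵥ (d * x))             ≡⟨ ψ-frame _ _ ⟩
        W₁ *ᵥ f (c * x) +ᵥ W₂ *ᵥ f (d * x)             ≡⟨ cong₂ (λ s s' → W₁ *ᵥ s +ᵥ W₂ *ᵥ s') (f-* _ x) (f-* _ x) ⟩
        W₁ *ᵥ (f c * g x) +ᵥ W₂ *ᵥ (f d * g x)         ≡⟨ *ᵥ-distribʳ W₁ W₂ _ _ _ ⟨
        (W₁ *ᵥ f c +ᵥ W₂ *ᵥ f d) *ᵥ g x                ≡⟨ cong₂ (λ s s' → (W₁ *ᵥ s +ᵥ W₂ *ᵥ s') *ᵥ g x) (inverseʳ _) (inverseʳ _) ⟩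
        (W₁ *ᵥ W.coord₁ w +ᵥ W₂ *ᵥ W.coord₂ w) *ᵥ g x  ≡⟨ cong (_*ᵥ g x) (W.decompose w) ⟨
        w *ᵥ g x                                       ∎ }
        where
        open ≡-Reasoning
        c = ζ⁻¹ (W.coord₁ w)
        d = ζ⁻¹ (W.coord₂ w)

      onChain₁⇒onChain₂ : ∀ v → OnChain M₁ v → OnChain M₂ v
      onChain₁⇒onChain₂ v (a , b , u≢0 , v≈u) =
        proj₁ w , proj₂ w , ≢0ᵥ⁻ (target-≢0ᵥ {ζ = g} (≢0ᵥ⁺ u≢0) (ψ-*ᵥ C)) ,
        ∼⇒SameSub {v} (∼-trans (SameSub⇒∼ {v} v≈u) (Corresponds⇒∼ C))
        where
        C = corresponds-forward (a , b)
        w = W₁ *ᵥ f (U.coord₁ (a , b)) +ᵥ W₂ *ᵥ f (U.coord₂ (a , b))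

      onChain₂⇒onChain₁ : ∀ v → OnChain M₂ v → OnChain M₁ v
      onChain₂⇒onChain₁ v (a , b , w≢0 , v≈w) =
        proj₁ u , proj₂ u , ≢0ᵥ⁻ (source-≢0ᵥ (≢0ᵥ⁺ w≢0) C) ,
        ∼⇒SameSub {v} (∼-trans (SameSub⇒∼ {v} v≈w) (∼-sym (Corresponds⇒∼ C)))
        where
        C = corresponds-backward (a , b)
        u = U₁ *ᵥ ζ⁻¹ (W.coord₁ (a , b)) +ᵥ U₂ *ᵥ ζ⁻¹ (W.coord₂ (a , b))

from-does : ∀ {A : Set} (a? : Dec A) → does a? ≡ true → A
from-does (yes a) _ = a

↔-injective : ∀ {A B : Set} (A↔B : A ↔ B) → Injective _≡_ _≡_ (Inverse.to A↔B)
↔-injective A↔B = Injection.injective (↔⇒↣ A↔B)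

Fin-↔⇒≡ : ∀ {m n} → Fin m ↔ Fin n → m ≡ n
Fin-↔⇒≡ m↔n = Fin.cantor-schröder-bernstein (↔-injective m↔n) (↔-injective (↔-sym m↔n))

module SubspaceCounting (L : Field) {N} (L↔Fin : Field.Carrier L ↔ Fin N) where
  open FieldProperties L
  open Finite L↔Fin using (_≟_; any?)
  open ℤ-Solver commutativeRing using (solve; _:+_; _:*_; _:-_; :-_; _:=_; con)

  -- subsets are Bool-valued so that membership proofs are unique, see element-≡
  Elements : (Carrier → Bool) → Set
  Elements P = Σ Carrier λ x → P x ≡ true

  element-≡ : ∀ {P : Carrier → Bool} {x y} {p : P x ≡ true} {p' : P y ≡ true} →
              x ≡ y → _≡_ {A = Elements P} (x , p) (y , p')
  element-≡ refl = cong (_ ,_) (Decidable⇒UIP.≡-irrelevant Bool._≟_ _ _)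

  card-≤ : ∀ {P n} → Elements P ↔ Fin n → n ≤ N
  card-≤ P↔Fin = Fin.injective⇒≤ λ eq →
    ↔-injective (↔-sym P↔Fin) (element-≡ (↔-injective L↔Fin eq))

  card-< : ∀ {P m a} → Elements P ↔ Fin m → P a ≡ false → m < N
  card-< {P} {m} {a} P↔Fin a∉P = Fin.injective⇒≤ {f = embed} injective
    where
    open Inverse P↔Fin using (from)
    embed : Fin (suc m) → Fin N
    embed Fin.zero = Inverse.to L↔Fin a
    embed (Fin.suc i) = Inverse.to L↔Fin (proj₁ (from i))
    a∉from : ∀ i → a ≢ proj₁ (from i)
    a∉from i a≡ with () ← trans (sym a∉P) (subst (λ x → P x ≡ true) (sym a≡) (proj₂ (from i)))
    injective : ∀ {i j} → embed i ≡ embed j → i ≡ j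
    injective {Fin.zero} {Fin.zero} _ = refl
    injective {Fin.zero} {Fin.suc j} eq = ⊥-elim (a∉from j (↔-injective L↔Fin eq))
    injective {Fin.suc i} {Fin.zero} eq = ⊥-elim (a∉from i (sym (↔-injective L↔Fin eq)))
    injective {Fin.suc i} {Fin.suc j} eq = cong Fin.suc (↔-injective (↔-sym P↔Fin) (element-≡ (↔-injective L↔Fin eq)))

  record IsSubfield (F : Carrier → Bool) : Set where
    field
      F-0 : F 0# ≡ true
      F-1 : F 1# ≡ true
      F-+ : ∀ x y → F x ≡ true → F y ≡ true → F (x + y) ≡ true
      F-neg : ∀ x → F x ≡ true → F (- x) ≡ true
      F-* : ∀ x y → F x ≡ true → F y ≡ true → F (x * y) ≡ true
      F-inverse : ∀ x y → F x ≡ true → x * y ≡ 1# → F y ≡ true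

  record IsSubspace (F V : Carrier → Bool) : Set where
    field
      V-0 : V 0# ≡ true
      V-+ : ∀ x y → V x ≡ true → V y ≡ true → V (x + y) ≡ true
      V-* : ∀ c x → F c ≡ true → V x ≡ true → V (c * x) ≡ true

  subfield-card≥2 : ∀ {F r} → IsSubfield F → Elements F ↔ Fin r → 2 ≤ r
  subfield-card≥2 {F} {r} F-subfield F↔Fin = Fin.injective⇒≤ {f = zero-one} injective
    where
    open IsSubfield F-subfield
    open Inverse F↔Fin
    zero-one : Fin 2 → Fin r
    zero-one Fin.zero = to (0# , F-0)
    zero-one (Fin.suc _) = to (1# , F-1)
    0≢1-in-F : to (0# , F-0) ≢ to (1# , F-1)
    0≢1-in-F eq = 0≢1 (cong proj₁ (↔-injective F↔Fin eq))
    injective : ∀ {i j} → zero-one i ≡ zero-one j → i ≡ j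
    injective {Fin.zero} {Fin.zero} _ = refl
    injective {Fin.zero} {Fin.suc Fin.zero} eq = ⊥-elim (0≢1-in-F eq)
    injective {Fin.suc Fin.zero} {Fin.zero} eq = ⊥-elim (0≢1-in-F (sym eq))
    injective {Fin.suc Fin.zero} {Fin.suc Fin.zero} _ = refl

  module Dimension {F} (F-subfield : IsSubfield F) {r} (F↔Fin : Elements F ↔ Fin r)
                   {V} (V-subspace : IsSubspace F V) where
    open IsSubfield F-subfield

    record PowerSubspace (k : ℕ) : Set where
      field
        W : Carrier → Bool
        W-subspace : IsSubspace F W
        W⊆V : ∀ x → W x ≡ true → V x ≡ true
        W↔Fin : Elements W ↔ Fin (r ^ k)

    zero-subspace : PowerSubspace 0
    zero-subspace = record
      { W = λ x → does (x ≟ 0#)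
      ; W-subspace = record
        { V-0 = dec-true (0# ≟ 0#) refl
        ; V-+ = λ x y x≡0 y≡0 → dec-true (_ ≟ 0#)
            (trans (cong₂ _+_ (from-does (x ≟ 0#) x≡0) (from-does (y ≟ 0#) y≡0)) (+-identityˡ 0#))
        ; V-* = λ c x _ x≡0 → dec-true (_ ≟ 0#) (trans (cong (c *_) (from-does (x ≟ 0#) x≡0)) (zeroʳ c))
        }
      ; W⊆V = λ x x≡0 → subst (λ z → V z ≡ true) (sym (from-does (x ≟ 0#) x≡0)) (IsSubspace.V-0 V-subspace)
      ; W↔Fin = mk↔ₛ′ (λ _ → Fin.zero) (λ _ → 0# , dec-true (0# ≟ 0#) refl)
          (λ { Fin.zero → refl ; (Fin.suc ()) }) (λ { (x , x≡0) → element-≡ (sym (from-does (x ≟ 0#) x≡0)) })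
      }

    module Extend {k} (S : PowerSubspace k) {v} (v∈V : V v ≡ true) (v∉W : PowerSubspace.W S v ≡ false) where
      open PowerSubspace S
      open IsSubspace W-subspace using () renaming (V-0 to W-0; V-+ to W-+; V-* to W-*)

      HasCoefficient : Carrier → Carrier → Set
      HasCoefficient x c = F c ≡ true × W (x - c * v) ≡ true

      hasCoefficient? : ∀ x c → Dec (HasCoefficient x c)
      hasCoefficient? x c = (F c Bool.≟ true) ×-dec (W (x - c * v) Bool.≟ true)

      -- W' = W + F v
      W' : Carrier → Bool
      W' x = does (any? (hasCoefficient? x))

      coefficient : ∀ {x} → W' x ≡ true → ∃ (HasCoefficient x)
      coefficient {x} = from-does (any? (hasCoefficient? x))

      W'-intro : ∀ {x c} → HasCoefficient x c → W' x ≡ true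
      W'-intro {x} has-c = dec-true (any? (hasCoefficient? x)) (_ , has-c)

      W-respects : ∀ {x y} → x ≡ y → W x ≡ true → W y ≡ true
      W-respects x≡y = subst (λ z → W z ≡ true) x≡y

      coefficient-unique : ∀ {x c c'} → HasCoefficient x c → HasCoefficient x c' → c ≡ c'
      coefficient-unique {x} {c} {c'} (c∈F , x-cv∈W) (c'∈F , x-c'v∈W) with (c' - c) ≟ 0#
      ... | yes c'-c≡0 = sym (x∙y⁻¹≈ε⇒x≈y c' c c'-c≡0)
      ... | no c'-c≢0 = ⊥-elim (true≢false (trans (sym v∈W) v∉W))
        where
        δ = c' - c
        δ⁻¹ = inv δ c'-c≢0
        true≢false : true ≢ false
        true≢false ()
        δv∈W : W (δ * v) ≡ true
        δv∈W = W-respects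
          (solve 4 (λ x c c' v → (x :- c :* v) :+ (:- con (ℤ.+ 1)) :* (x :- c' :* v) := (c' :- c) :* v) refl x c c' v)
          (W-+ _ _ x-cv∈W (W-* (- 1#) _ (F-neg 1# F-1) x-c'v∈W))
        v∈W : W v ≡ true
        v∈W = W-respects (trans (sym (*-assoc δ⁻¹ δ v)) (trans (cong (_* v) (*-inverseˡ δ c'-c≢0)) (*-identityˡ v)))
          (W-* δ⁻¹ (δ * v) (F-inverse δ δ⁻¹ (F-+ c' (- c) c'∈F (F-neg c c∈F)) (*-inverseʳ δ c'-c≢0)) δv∈W)

      w≡cv+w-cv : ∀ c w → w ≡ (c * v + w) - c * v
      w≡cv+w-cv c w = solve 3 (λ c v w → w := (c :* v :+ w) :- c :* v) refl c v w

      split : Elements W' → Elements F × Elements W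
      split (x , x∈W') = let c , c∈F , x-cv∈W = coefficient x∈W' in (c , c∈F) , (x - c * v , x-cv∈W)

      join : Elements F × Elements W → Elements W'
      join ((c , c∈F) , (w , w∈W)) = c * v + w , W'-intro (c∈F , W-respects (w≡cv+w-cv c w) w∈W)

      W'↔F×W : Elements W' ↔ (Elements F × Elements W)
      W'↔F×W = mk↔ₛ′ split join split-join join-split
        where
        split-join : ∀ y → split (join y) ≡ y
        split-join y@((c , c∈F) , (w , w∈W)) = cong₂ _,_ (element-≡ c'≡c)
            (element-≡ (trans (cong (λ z → (c * v + w) - z * v) c'≡c) (sym (w≡cv+w-cv c w))))
          where
          has-c' = proj₂ (coefficient (proj₂ (join y)))
          c'≡c = coefficient-unique has-c' (c∈F , W-respects (w≡cv+w-cv c w) w∈W)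
        join-split : ∀ x → join (split x) ≡ x
        join-split (x , x∈W') = element-≡ (solve 3 (λ c v x → c :* v :+ (x :- c :* v) := x) refl _ v x)

      extended : PowerSubspace (suc k)
      extended = record
        { W = W'
        ; W-subspace = record
          { V-0 = W'-intro (F-0 , W-respects (solve 1 (λ v → con (ℤ.+ 0) := con (ℤ.+ 0) :- con (ℤ.+ 0) :* v) refl v) W-0)
          ; V-+ = λ x y x∈W' y∈W' → W'-+ (proj₂ (coefficient x∈W')) (proj₂ (coefficient y∈W'))
          ; V-* = λ e x e∈F x∈W' → W'-* e∈F (proj₂ (coefficient x∈W'))
          }
        ; W⊆V = λ x x∈W' → W'⊆V (proj₂ (coefficient x∈W'))
        ; W↔Fin = ↔-trans W'↔F×W (↔-trans (F↔Fin ×-↔ W↔Fin) (↔-sym Fin.*↔×))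
        }
        where
        W'-+ : ∀ {x y c c'} → HasCoefficient x c → HasCoefficient y c' → W' (x + y) ≡ true
        W'-+ {x} {y} {c} {c'} (c∈F , x-cv∈W) (c'∈F , y-c'v∈W) = W'-intro (F-+ c c' c∈F c'∈F ,
          W-respects (solve 5 (λ x y c c' v → (x :- c :* v) :+ (y :- c' :* v) := (x :+ y) :- (c :+ c') :* v) refl x y c c' v)
            (W-+ _ _ x-cv∈W y-c'v∈W))
        W'-* : ∀ {e x c} → F e ≡ true → HasCoefficient x c → W' (e * x) ≡ true
        W'-* {e} {x} {c} e∈F (c∈F , x-cv∈W) = W'-intro (F-* e c e∈F c∈F ,
          W-respects (solve 4 (λ e x c v → e :* (x :- c :* v) := e :* x :- (e :* c) :* v) refl e x c v) (W-* e _ e∈F x-cv∈W))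
        W'⊆V : ∀ {x c} → HasCoefficient x c → V x ≡ true
        W'⊆V {x} {c} (c∈F , x-cv∈W) = subst (λ z → V z ≡ true)
          (solve 3 (λ x c v → (x :- c :* v) :+ c :* v := x) refl x c v)
          (IsSubspace.V-+ V-subspace _ _ (W⊆V _ x-cv∈W) (IsSubspace.V-* V-subspace c v c∈F v∈V))

    private
      r≥2 : 2 ≤ r
      r≥2 = subfield-card≥2 F-subfield F↔Fin

      V⊆W? : ∀ {k} (S : PowerSubspace k) → Dec (∃ λ v → V v ≡ true × PowerSubspace.W S v ≡ false)
      V⊆W? S = any? λ v → (V v Bool.≟ true) ×-dec (PowerSubspace.W S v Bool.≟ false)

      -- the fuel bounds the number of extensions, since r ^ k ≤ N for every power subspace
      grow : ∀ fuel {k} → PowerSubspace k → N < r ^ k ℕ.+ fuel → ∃[ k' ] Elements V ↔ Fin (r ^ k')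
      grow zero {k} S N<r^k+0 =
        ⊥-elim (ℕ.<⇒≱ (subst (N <_) (ℕ.+-identityʳ (r ^ k)) N<r^k+0) (card-≤ (PowerSubspace.W↔Fin S)))
      grow (suc fuel) {k} S N<r^k+1+fuel with V⊆W? S
      ... | yes (v , v∈V , v∉W) = grow fuel (Extend.extended S v∈V v∉W) (begin-strict
            N                      <⟨ N<r^k+1+fuel ⟩
            r ^ k ℕ.+ suc fuel     ≡⟨ ℕ.+-suc (r ^ k) fuel ⟩
            suc (r ^ k) ℕ.+ fuel   ≤⟨ ℕ.+-monoˡ-≤ fuel (ℕ.^-monoʳ-< r r≥2 (ℕ.n<1+n k)) ⟩
            r ^ suc k ℕ.+ fuel     ∎)
        where open ℕ.≤-Reasoning
      ... | no ∄v = k , ↔-trans V↔W (PowerSubspace.W↔Fin S)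
        where
        open PowerSubspace S using (W; W⊆V)
        V⊆W : ∀ x → V x ≡ true → W x ≡ true
        V⊆W x x∈V with W x in eq
        ... | true = refl
        ... | false = ⊥-elim (∄v (x , x∈V , eq))
        V↔W : Elements V ↔ Elements W
        V↔W = mk↔ₛ′ (λ (x , x∈V) → x , V⊆W x x∈V) (λ (x , x∈W) → x , W⊆V x x∈W)
                    (λ _ → element-≡ refl) (λ _ → element-≡ refl)

    subspace-card : ∃[ k ] Elements V ↔ Fin (r ^ k)
    subspace-card = grow N zero-subspace (ℕ.n<1+n N)

^-injectiveʳ : ∀ q {a b} → 2 ≤ q → q ^ a ≡ q ^ b → a ≡ b
^-injectiveʳ q {a} {b} q≥2 q^a≡q^b with ℕ.<-cmp a b
... | tri< a<b _ _ = ⊥-elim (ℕ.<-irrefl q^a≡q^b (ℕ.^-monoʳ-< q q≥2 a<b))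
... | tri≈ _ a≡b _ = a≡b
... | tri> _ _ a>b = ⊥-elim (ℕ.<-irrefl (sym q^a≡q^b) (ℕ.^-monoʳ-< q q≥2 a>b))

proper-subpower-bound : ∀ {q t s d m} → 2 ≤ q → IsGreatestProperDivisor t s →
                       (q ^ d) ^ m ≡ q ^ t → q ^ d < q ^ t → q ^ d ≤ q ^ s
proper-subpower-bound {q@(suc _)} {t} {s} {zero} q≥2 _ _ _ = ℕ.m^n>0 q s
proper-subpower-bound {q@(suc _)} {t} {s} {d@(suc _)} {m} q≥2 (_ , _ , _ , greatest) [q^d]^m≡q^t q^d<q^t =
  ℕ.^-monoʳ-≤ q (greatest d (s≤s z≤n) d<t (divides m (trans (sym d*m≡t) (ℕ.*-comm d m))))
  where
  d*m≡t : d ℕ.* m ≡ t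
  d*m≡t = ^-injectiveʳ q q≥2 (trans (sym (ℕ.^-*-assoc q d m)) [q^d]^m≡q^t)
  d<t : d < t
  d<t = ℕ.≰⇒> (λ t≤d → ℕ.<⇒≱ q^d<q^t (ℕ.^-monoʳ-≤ q t≤d))

lookup-AllPairs : ∀ {A : Set} {R : A → A → Set} → Symmetric R → ∀ {xs} → AllPairs R xs →
                  ∀ {i j : Fin (length xs)} → i ≢ j → R (lookup xs i) (lookup xs j)
lookup-AllPairs sym (_ ∷ _) {Fin.zero} {Fin.zero} i≢j = ⊥-elim (i≢j refl)
lookup-AllPairs sym (Rx ∷ _) {Fin.zero} {Fin.suc j} _ = All.lookup Rx (∈-lookup j)
lookup-AllPairs sym (Rx ∷ _) {Fin.suc i} {Fin.zero} _ = sym (All.lookup Rx (∈-lookup i))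
lookup-AllPairs sym (_ ∷ Rxs) {Fin.suc i} {Fin.suc j} i≢j = lookup-AllPairs sym Rxs (i≢j ∘ cong Fin.suc)

prime-power≥2 : ∀ {q} → IsPrimePower q → 2 ≤ q
prime-power≥2 (p , k , prime _ , refl) =
  ℕ.≤-trans (ℕ.nonTrivial⇒n>1 p) (ℕ.m≤m*n p (p ^ k) {{ℕ.m^n≢0 p k {{ℕ.nonTrivial⇒nonZero p}}}})

module CommonPointBound {q t s} (q≥2 : 2 ≤ q) (s-greatest : IsGreatestProperDivisor t s)
    (FE : FieldExt q t) (M₁ M₂ : Chains.Mat FE) (M₁∈GL₂ : Chains.InGL2 FE M₁) (M₂∈GL₂ : Chains.InGL2 FE M₂)
    (distinct : Chains.DistinctChains FE M₁ M₂) (vs : List (Chains.Pair FE)) (common : Chains.CommonPoints FE M₁ M₂ vs) where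
  open FieldExt FE using (L; inK; K0; K1; K+; K-; K*; Kinv; cardK; cardL)
  open FieldProperties L
  open FrameConstruction FE M₁ M₂ M₁∈GL₂ M₂∈GL₂
  open SubspaceCounting L cardL
  open Finite cardL using (all?; any?)
  open Corresponds

  K-subfield : IsSubfield inK
  K-subfield = record { F-0 = K0 ; F-1 = K1 ; F-+ = K+ ; F-neg = K- ; F-* = K* ; F-inverse = Kinv }

  record Coordinates (v : Pair) : Set where
    field
      u w : L²
      u≢0 : u ≢ 0ᵥ
      v∼u : v ∼ chainPoint M₁ u
      u↦w : Corresponds u w

  coordinates : ∀ {v} → OnChain M₁ v → OnChain M₂ v → Coordinates v
  coordinates {v} (a , b , u≢0 , v≈u) (a' , b' , _ , v≈w) = record
    { u = a , b ; w = a' , b' ; u≢0 = ≢0ᵥ⁺ u≢0 ; v∼u = SameSub⇒∼ {v} v≈u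
    ; u↦w = ∼⇒Corresponds (≢0ᵥ⁺ u≢0) (∼-trans (∼-sym (SameSub⇒∼ {v} v≈u)) (SameSub⇒∼ {v} v≈w))
    }

  n : ℕ
  n = length vs

  point : (i : Fin n) → Coordinates (lookup vs i)
  point i = let _ , on₁ , on₂ = All.lookup (proj₁ common) (∈-lookup i) in coordinates on₁ on₂

  open Coordinates

  independent : ∀ {i j} → i ≢ j → det (u (point i)) (u (point j)) ≢ 0#
  independent {i} {j} i≢j = independent-points M₁ (u≢0 (point i)) (u≢0 (point j)) (v∼u (point i)) (v∼u (point j))
    (lookup-AllPairs (λ ¬vw wv → ¬vw (proj₂ wv , proj₁ wv)) (proj₂ common) i≢j)

  module ThreePoints (i₀ i₁ i₂ : Fin n) (i₀≢i₁ : i₀ ≢ i₁) (i₀≢i₂ : i₀ ≢ i₂) (i₁≢i₂ : i₁ ≢ i₂) where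
    open InFrame (FromThreePoints.frame (u≢0 (point i₀)) (u↦w (point i₀)) (u↦w (point i₁)) (u↦w (point i₂))
                                        (independent i₀≢i₁) (independent i₀≢i₂) (independent i₁≢i₂))

    multiplicative? : ∀ a → Dec (Multiplicative a)
    multiplicative? a = all? λ y → f (a * y) * f 1# ≟ f a * f y

    S : Carrier → Bool
    S a = does (multiplicative? a)

    from-S : ∀ {a} → S a ≡ true → Multiplicative a
    from-S {a} = from-does (multiplicative? a)

    to-S : ∀ {a} → Multiplicative a → S a ≡ true
    to-S {a} = dec-true (multiplicative? a)

    S-subfield : IsSubfield S
    S-subfield = record
      { F-0 = to-S multiplicative-0
      ; F-1 = to-S (multiplicative-K 1# K1)
      ; F-+ = λ _ _ a∈S b∈S → to-S (multiplicative-+ (from-S a∈S) (from-S b∈S))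
      ; F-neg = λ _ a∈S → to-S (multiplicative-neg (from-S a∈S))
      ; F-* = λ _ _ a∈S b∈S → to-S (multiplicative-* (from-S a∈S) (from-S b∈S))
      ; F-inverse = λ _ _ a∈S ab≡1 → to-S (multiplicative-inverse (from-S a∈S) ab≡1)
      }

    S-over-K : IsSubspace inK S
    S-over-K = record
      { V-0 = to-S multiplicative-0
      ; V-+ = λ _ _ a∈S b∈S → to-S (multiplicative-+ (from-S a∈S) (from-S b∈S))
      ; V-* = λ c _ c∈K a∈S → to-S (multiplicative-* (multiplicative-K c c∈K) (from-S a∈S))
      }

    L-over-S : IsSubspace S (λ _ → true)
    L-over-S = record { V-0 = refl ; V-+ = λ _ _ _ _ → refl ; V-* = λ _ _ _ _ → refl }

    module Coding {m} (S↔Fin : Elements S ↔ Fin m) where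
      -- a common point is coded by the slope of its coordinates in the frame, or by zero when that slope is infinite
      code-with : ∀ i → Dec (U.coord₁ (u (point i)) ≡ 0#) → Fin (suc m)
      code-with i (yes _) = Fin.zero
      code-with i (no c≢0) =
        Fin.suc (Inverse.to S↔Fin (slope (u (point i)) c≢0 , to-S (slope-multiplicative (u↦w (point i)) c≢0)))

      code : Fin n → Fin (suc m)
      code i = code-with i (U.coord₁ (u (point i)) ≟ 0#)

      same-code⇒det≡0 : ∀ i j c₁? c₂? → code-with i c₁? ≡ code-with j c₂? → det (u (point i)) (u (point j)) ≡ 0#
      same-code⇒det≡0 i j (yes c≡0) (yes c'≡0) _ = coord₁≡0⇒det≡0 c≡0 c'≡0
      same-code⇒det≡0 i j (yes _) (no _) ()
      same-code⇒det≡0 i j (no _) (yes _) ()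
      same-code⇒det≡0 i j (no c≢0) (no c'≢0) eq =
        slope-injective {u (point i)} {u (point j)} c≢0 c'≢0 (cong proj₁ (↔-injective S↔Fin (Fin.suc-injective eq)))

      code-injective : ∀ {i j} → code i ≡ code j → i ≡ j
      code-injective {i} {j} eq = decidable-stable (i Fin.≟ j) λ i≢j →
        independent i≢j (same-code⇒det≡0 i j _ _ eq)

      n≤1+m : n ≤ suc m
      n≤1+m = Fin.injective⇒≤ {f = code} code-injective

    module Proper {a₀} (a₀-not-multiplicative : ¬ Multiplicative a₀) where
      private
        S-dimension = Dimension.subspace-card K-subfield cardK S-over-K
        d = proj₁ S-dimension
        S↔Fin : Elements S ↔ Fin (q ^ d)
        S↔Fin = proj₂ S-dimension
        L-dimension = Dimension.subspace-card S-subfield S↔Fin L-over-S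
        L↔Fin : Elements (λ _ → true) ↔ Fin ((q ^ d) ^ proj₁ L-dimension)
        L↔Fin = proj₂ L-dimension
        Elements-all↔L : Elements (λ _ → true) ↔ Carrier
        Elements-all↔L = mk↔ₛ′ proj₁ (λ x → x , refl) (λ _ → refl) (λ _ → element-≡ refl)

      S-card≤q^s : q ^ d ≤ q ^ s
      S-card≤q^s = proper-subpower-bound {d = d} {m = proj₁ L-dimension} q≥2 s-greatest
        (Fin-↔⇒≡ (↔-trans (↔-sym L↔Fin) (↔-trans Elements-all↔L cardL)))
        (card-< S↔Fin (dec-false (multiplicative? a₀) a₀-not-multiplicative))

      n≤q^s+1 : n ≤ q ^ s ℕ.+ 1
      n≤q^s+1 = begin
        n               ≤⟨ Coding.n≤1+m S↔Fin ⟩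
        suc (q ^ d)     ≤⟨ s≤s S-card≤q^s ⟩
        suc (q ^ s)     ≡⟨ ℕ.+-comm 1 (q ^ s) ⟩
        q ^ s ℕ.+ 1     ∎
        where open ℕ.≤-Reasoning

    not-all-multiplicative : ¬ (∀ a → Multiplicative a)
    not-all-multiplicative all-multiplicative = distinct λ v _ → onChain₁⇒onChain₂ v , onChain₂⇒onChain₁ v
      where open AllMultiplicative all-multiplicative

    n≤q^s+1 : n ≤ q ^ s ℕ.+ 1
    n≤q^s+1 with any? (¬? ∘ multiplicative?)
    ... | yes (a₀ , a₀-not-multiplicative) = Proper.n≤q^s+1 a₀-not-multiplicative
    ... | no ∄a₀ = ⊥-elim (not-all-multiplicative λ a → decidable-stable (multiplicative? a) (∄a₀ ∘ (a ,_)))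

open import Data.Nat using (_+_)

lemma15 : (q t s : ℕ) → IsPrimePower q → 2 ≤ t → IsGreatestProperDivisor t s →
    (FE : FieldExt q t) → (M₁ M₂ : Chains.Mat FE) →
    Chains.InGL2 FE M₁ → Chains.InGL2 FE M₂ → Chains.DistinctChains FE M₁ M₂ →
    (vs : List (Chains.Pair FE)) → Chains.CommonPoints FE M₁ M₂ vs →
    length vs ≤ q ^ s + 1
lemma15 q t s q-prime-power _ s-greatest FE M₁ M₂ M₁∈GL₂ M₂∈GL₂ distinct vs common = bound vs common
  where
  q≥2 = prime-power≥2 q-prime-power
  bound : (xs : List (Chains.Pair FE)) → Chains.CommonPoints FE M₁ M₂ xs → length xs ≤ q ^ s + 1
  bound [] _ = z≤n
  bound (_ ∷ []) _ = ℕ.m≤n+m 1 (q ^ s)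
  bound (_ ∷ _ ∷ []) _ = ℕ.+-monoˡ-≤ 1 (ℕ.m^n>0 q {{ℕ.>-nonZero (ℕ.≤-trans (s≤s z≤n) q≥2)}} s)
  bound xs@(_ ∷ _ ∷ _ ∷ _) xs-common =
    CommonPointBound.ThreePoints.n≤q^s+1 q≥2 s-greatest FE M₁ M₂ M₁∈GL₂ M₂∈GL₂ distinct xs xs-common
      Fin.zero (Fin.suc Fin.zero) (Fin.suc (Fin.suc Fin.zero)) (λ ()) (λ ()) (λ ())
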